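{- Every pyramid-basic graph contains no theta, no wheel and no prism as an induced subgraph.
   Context: An edge of a tree $T$ is pendant if one of its ends has degree 1. Two pendant edges of $T$ are siblings if the unique path of $T$ linking them contains at most one node of degree at least 3. $T$ is safe if for every node $u$ of degree 1, the neighbor $v$ of $u$ has degree at most 2 and $uv$ has at most one sibling. A pyramid-basic graph is obtained as follows: take a safe tree $T$, label each pendant edge of $T$ with $x$ or $y$ so that the two members of any pair of siblings get distinct labels; form the line graph $L(T)$ (nodes are edges of $T$, adjacent when sharing an end); then add a node $x$ adjacent to every node of $L(T)$ labelled $x$, and a node $y$ adjacent to $x$ and to every node labelled $y$. A hole is a chordless cycle of length at least 4. A prism consists of three node-disjoint chordless paths $a_1\dots b_1$, $a_2\dots b_2$, $a_3\dots b_3$ of length at least 1 such that $a_1a_2a_3$ and $b_1b_2b_3$ are triangles and there are no other edges between the paths. A theta consists of three internally node-disjoint chordless paths between two nodes $a,b$, each of length at least 2, with no edges between the paths other than the three edges at $a$ and the three at $b$. A wheel is a hole $H$ plus a node $c\notin V(H)$ with at least three neighbors in $H$. -}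

module Defs where

open import Data.Nat using (ℕ; zero; suc; _+_; _≤_; _<_)
open import Data.Fin using (Fin; toℕ; fromℕ; inject₁) renaming (zero to fzero; suc to fsuc)
open import Data.Bool using (Bool; true; false; if_then_else_)
open import Data.List using (List; map; allFin)
open import Data.Nat.ListAction using (sum)
open import Data.Unit using (⊤)
open import Data.Product using (Σ; Σ-syntax; ∃; _×_; _,_; proj₁; proj₂)
open import Data.Sum using (_⊎_)
open import Data.Empty using (⊥)
open import Relation.Nullary using (¬_)
open import Relation.Binary.PropositionalEquality using (_≡_; _≢_)

record Graph : Set₁ where
  field
    V   : Set
    Adj : V → V → Set
open Graph public

Consec : ∀ {k} → Fin k → Fin k → Set
Consec i j = suc (toℕ i) ≡ toℕ j ⊎ suc (toℕ j) ≡ toℕ i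

CycSucc : ∀ k → Fin k → Fin k → Set
CycSucc k i j = suc (toℕ i) ≡ toℕ j ⊎ (suc (toℕ i) ≡ k × toℕ j ≡ 0)

CycConsec : ∀ k → Fin k → Fin k → Set
CycConsec k i j = CycSucc k i j ⊎ CycSucc k j i

record CPath (G : Graph) : Set where
  field
    len       : ℕ
    node      : Fin (suc len) → V G
    inj       : ∀ i j → node i ≡ node j → i ≡ j
    chordless : ∀ i j → (Adj G (node i) (node j) → Consec i j)
                      × (Consec i j → Adj G (node i) (node j))
open CPath public

first : ∀ {G} → CPath G → V G
first P = node P fzero

last : ∀ {G} → CPath G → V G
last P = node P (fromℕ (len P))

Interior : ∀ {G} (P : CPath G) → Fin (suc (len P)) → Set
Interior P s = 0 < toℕ s × toℕ s < len P

record Hole (G : Graph) : Set where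
  field
    size      : ℕ
    size≥4    : 4 ≤ size
    hnode     : Fin size → V G
    hinj      : ∀ i j → hnode i ≡ hnode j → i ≡ j
    hchordless : ∀ i j → (Adj G (hnode i) (hnode j) → CycConsec size i j)
                       × (CycConsec size i j → Adj G (hnode i) (hnode j))
open Hole public

Theta : Graph → Set
Theta G =
  Σ[ a ∈ V G ] Σ[ b ∈ V G ] Σ[ P ∈ (Fin 3 → CPath G) ]
    (∀ i → first (P i) ≡ a × last (P i) ≡ b × 2 ≤ len (P i))
  × (∀ i j → i ≢ j → ∀ s t → Interior (P i) s → node (P i) s ≢ node (P j) t)
  × (∀ i j → i ≢ j → ∀ s t → Interior (P i) s → Interior (P j) t →
       ¬ Adj G (node (P i) s) (node (P j) t))

Prism : Graph → Set
Prism G =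
  Σ[ P ∈ (Fin 3 → CPath G) ]
    (∀ i → 1 ≤ len (P i))
  × (∀ i j → i ≢ j → ∀ s t → node (P i) s ≢ node (P j) t)
  × (∀ i j → i ≢ j → Adj G (first (P i)) (first (P j)))
  × (∀ i j → i ≢ j → Adj G (last (P i)) (last (P j)))
  × (∀ i j → i ≢ j → ∀ s t → Adj G (node (P i) s) (node (P j) t) →
       (toℕ s ≡ 0 × toℕ t ≡ 0) ⊎ (toℕ s ≡ len (P i) × toℕ t ≡ len (P j)))

Wheel : Graph → Set
Wheel G =
  Σ[ H ∈ Hole G ] Σ[ c ∈ V G ]
    (∀ i → c ≢ hnode H i)
  × (Σ[ i ∈ Fin (size H) ] Σ[ j ∈ Fin (size H) ] Σ[ l ∈ Fin (size H) ]
       (i ≢ j × i ≢ l × j ≢ l)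
     × Adj G c (hnode H i) × Adj G c (hnode H j) × Adj G c (hnode H l))

record Tree : Set where
  field
    m        : ℕ
    nonempty : 0 < m
    adj      : Fin m → Fin m → Bool
    adj-sym  : ∀ u v → adj u v ≡ adj v u
    adj-irr  : ∀ u → adj u u ≡ false
open Tree public

record TPath (T : Tree) (k : ℕ) : Set where
  field
    pnode : Fin (suc k) → Fin (m T)
    pinj  : ∀ i j → pnode i ≡ pnode j → i ≡ j
    padj  : ∀ (i : Fin k) → adj T (pnode (inject₁ i)) (pnode (fsuc i)) ≡ true
open TPath public

IsTree : Tree → Set
IsTree T =
    (∀ u v → Σ[ k ∈ ℕ ] Σ[ p ∈ TPath T k ]
               pnode p fzero ≡ u × pnode p (fromℕ k) ≡ v)
    -- acyclic: no cycle (a path on ≥ 3 nodes whose ends are adjacent)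
  × (∀ k (p : TPath T (suc (suc k))) →
       adj T (pnode p (fromℕ (suc (suc k)))) (pnode p fzero) ≡ true → ⊥)

deg : (T : Tree) → Fin (m T) → ℕ
deg T u = sum (map (λ v → if adj T u v then 1 else 0) (allFin (m T)))

-- edges of T, stored with ends ordered (src < tgt)
Edge : Tree → Set
Edge T = Σ[ u ∈ Fin (m T) ] Σ[ v ∈ Fin (m T) ] (toℕ u < toℕ v × adj T u v ≡ true)

src : ∀ T → Edge T → Fin (m T)
src T e = proj₁ e

tgt : ∀ T → Edge T → Fin (m T)
tgt T e = proj₁ (proj₂ e)

Ends : ∀ T → Edge T → Fin (m T) → Fin (m T) → Set
Ends T e p q = (src T e ≡ p × tgt T e ≡ q) ⊎ (src T e ≡ q × tgt T e ≡ p)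

SameEdge : ∀ T → Edge T → Edge T → Set
SameEdge T e f = src T e ≡ src T f × tgt T e ≡ tgt T f

Incident : ∀ T → Fin (m T) → Edge T → Set
Incident T w e = w ≡ src T e ⊎ w ≡ tgt T e

Pendant : ∀ T → Edge T → Set
Pendant T e = deg T (src T e) ≡ 1 ⊎ deg T (tgt T e) ≡ 1

-- pendant edges e ≠ f are siblings if the path of T linking them
-- (first edge e, last edge f) contains at most one node of degree ≥ 3
Siblings : ∀ T → Edge T → Edge T → Set
Siblings T e f =
    Pendant T e × Pendant T f × ¬ SameEdge T e f
  × Σ[ k ∈ ℕ ] Σ[ p ∈ TPath T (suc k) ]
      Ends T e (pnode p fzero) (pnode p (fsuc fzero))
    × Ends T f (pnode p (inject₁ (fromℕ k))) (pnode p (fromℕ (suc k)))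
    × (∀ i j → 3 ≤ deg T (pnode p i) → 3 ≤ deg T (pnode p j) → i ≡ j)

Safe : Tree → Set
Safe T = ∀ u → deg T u ≡ 1 → ∀ v → adj T u v ≡ true →
           deg T v ≤ 2
         × (∀ (e : Edge T) → Ends T e u v →
              ∀ f g → Siblings T e f → Siblings T e g → SameEdge T f g)

data Label : Set where
  X Y : Label

-- labelling of pendant edges (values on non-pendant edges are irrelevant)
ProperLabelling : (T : Tree) → (Edge T → Label) → Set
ProperLabelling T lab = ∀ e f → Siblings T e f → lab e ≢ lab f

data PBV (T : Tree) : Set where
  ln : Edge T → PBV T
  vx : PBV T
  vy : PBV T

PBAdj : (T : Tree) → (Edge T → Label) → PBV T → PBV T → Set
PBAdj T lab (ln e) (ln f) = ¬ SameEdge T e f × Σ[ w ∈ Fin (m T) ] (Incident T w e × Incident T w f)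
PBAdj T lab (ln e) vx     = Pendant T e × lab e ≡ X
PBAdj T lab (ln e) vy     = Pendant T e × lab e ≡ Y
PBAdj T lab vx     (ln e) = Pendant T e × lab e ≡ X
PBAdj T lab vy     (ln e) = Pendant T e × lab e ≡ Y
PBAdj T lab vx     vy     = ⊤
PBAdj T lab vy     vx     = ⊤
PBAdj T lab vx     vx     = ⊥
PBAdj T lab vy     vy     = ⊥

PyramidBasic : (T : Tree) → (Edge T → Label) → Graph
PyramidBasic T lab = record { V = PBV T ; Adj = PBAdj T lab }

-- Call x, y the two added vertices and the vertices ln e of L(T) line vertices. Consecutive
-- vertices of a chordless path of line vertices share an end in T, and these ends trace a path of T.
-- Since T is acyclic, there is no hole of line vertices, and a chordless path of line vertices
-- not through ln e contains at most two neighbours of ln e: two containing different ends of e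
-- would close a cycle of T, three containing the same end would be pairwise adjacent.
-- Theta: the neighbourhood of a line vertex is covered by two cliques (edges at either end, with x
-- or y taking the place of the leaf end of a pendant edge), so the two ends of a theta are x and y;
-- but these are adjacent.
-- Prism: x and y cannot lie on different paths (they would lie in a common triangle whose third
-- vertex sees both), so two of the paths consist of line vertices and together form a hole.
-- Wheel: a centre x or y sees only pendant line vertices, and on a hole such a vertex has a
-- neighbour x or y, necessarily the centre. A pendant centre sees at most one of x, y and, by
-- safety, at most one line vertex of the hole. A non-pendant centre sees only line vertices; they
-- lie on the arc of line vertices left by removing x and y from the hole.

module Submission where

open import Defs
open import Data.Bool using (Bool; true; if_then_else_)
open import Data.Empty using (⊥; ⊥-elim)
open import Data.Fin using (Fin; toℕ; fromℕ; fromℕ<) renaming (zero to fzero; suc to fsuc)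
open import Data.Fin.Patterns using (0F; 1F; 2F)
import Data.Fin.Properties as Fin
open import Data.List using (tabulate)
open import Data.List.Properties using (map-tabulate)
open import Data.Nat using (ℕ; zero; suc; _+_; _∸_; _≤_; _<_; z≤n; s≤s; pred; >-nonZero)
open import Data.Nat.DivMod using (_%_; %-distribˡ-+; m%n%n≡m%n; [m+n]%n≡m%n; n%n≡0; m<n⇒m%n≡m; m%n<n)
open import Data.Nat.ListAction using (sum)
open import Data.Nat.Properties
open import Data.Product using (Σ-syntax; _×_; _,_; proj₁; proj₂)
open import Data.Sum using (_⊎_; inj₁; inj₂)
open import Data.Unit using (tt)
open import Function using (_∘_)
open import Relation.Binary.Definitions using (Symmetric; tri<; tri≈; tri>)
open import Relation.Binary.PropositionalEquality
open import Relation.Nullary using (¬_; Dec; yes; no)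

-- Paths and holes indexed by ℕ

Consecutive : ℕ → ℕ → Set
Consecutive i j = suc i ≡ j ⊎ suc j ≡ i

no-consecutive-triple : ∀ p q r → p ≢ q → p ≢ r → q ≢ r → Consecutive p q → Consecutive p r → Consecutive q r → ⊥
no-consecutive-triple p q r _ _ q≢r (inj₁ refl) (inj₁ refl) _ = q≢r refl
no-consecutive-triple p q r _ _ q≢r (inj₂ refl) (inj₂ refl) _ = q≢r refl
no-consecutive-triple p q r _ _ _ (inj₁ refl) (inj₂ refl) (inj₁ eq) = <-irrefl (sym eq) (s≤s (m≤n+m r 2))
no-consecutive-triple p q r _ _ _ (inj₁ refl) (inj₂ refl) (inj₂ eq) = <-irrefl eq (s≤s (m≤n+m (suc r) 0))
no-consecutive-triple p q r _ _ _ (inj₂ refl) (inj₁ refl) (inj₁ eq) = <-irrefl eq (s≤s (m≤n+m (suc q) 0))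
no-consecutive-triple p q r _ _ _ (inj₂ refl) (inj₁ refl) (inj₂ eq) = <-irrefl (sym eq) (s≤s (m≤n+m q 2))

CycSuccℕ : ℕ → ℕ → ℕ → Set
CycSuccℕ n i j = suc i ≡ j ⊎ (suc i ≡ n × j ≡ 0)

CycConsecℕ : ℕ → ℕ → ℕ → Set
CycConsecℕ n i j = CycSuccℕ n i j ⊎ CycSuccℕ n j i

CycConsecℕ-sym : ∀ {n i j} → CycConsecℕ n i j → CycConsecℕ n j i
CycConsecℕ-sym (inj₁ c) = inj₂ c
CycConsecℕ-sym (inj₂ c) = inj₁ c

record PathSeq (G : Graph) : Set where
  field
    end             : ℕ
    vtx             : ℕ → V G
    vtx-injective   : ∀ i j → i ≤ end → j ≤ end → vtx i ≡ vtx j → i ≡ j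
    adj⇒consecutive : ∀ i j → i ≤ end → j ≤ end → Adj G (vtx i) (vtx j) → Consecutive i j
    step-adj        : ∀ i → i < end → Adj G (vtx i) (vtx (suc i))

record HoleSeq (G : Graph) : Set where
  field
    top                 : ℕ
    3≤top               : 3 ≤ top
    cvtx                : ℕ → V G
    cvtx-injective      : ∀ i j → i < suc top → j < suc top → cvtx i ≡ cvtx j → i ≡ j
    adj⇒cyc-consecutive : ∀ i j → i < suc top → j < suc top →
                          Adj G (cvtx i) (cvtx j) → CycConsecℕ (suc top) i j
    cyc-consecutive⇒adj : ∀ i j → i < suc top → j < suc top →
                          CycConsecℕ (suc top) i j → Adj G (cvtx i) (cvtx j)

module CyclicShift (top : ℕ) where
  N : ℕ
  N = suc top

  %-absorbˡ : ∀ a b → (a % N + b) % N ≡ (a + b) % N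
  %-absorbˡ a b = begin
    (a % N + b) % N         ≡⟨ %-distribˡ-+ (a % N) b N ⟩
    (a % N % N + b % N) % N ≡⟨ cong (λ x → (x + b % N) % N) (m%n%n≡m%n a N) ⟩
    (a % N + b % N) % N     ≡⟨ %-distribˡ-+ a b N ⟨
    (a + b) % N             ∎
    where open ≡-Reasoning

  %-absorbʳ : ∀ a b → (a + b % N) % N ≡ (a + b) % N
  %-absorbʳ a b = begin
    (a + b % N) % N ≡⟨ cong (_% N) (+-comm a (b % N)) ⟩
    (b % N + a) % N ≡⟨ %-absorbˡ b a ⟩
    (b + a) % N     ≡⟨ cong (_% N) (+-comm b a) ⟩
    (a + b) % N     ∎
    where open ≡-Reasoning

  next : ℕ → ℕ
  next i = suc i % N

  shift : ℕ → ℕ → ℕ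
  shift z s = (z + s) % N

  unshift : ℕ → ℕ → ℕ
  unshift z i = (i + (N ∸ z)) % N

  shift<N : ∀ z s → shift z s < N
  shift<N z s = m%n<n (z + s) N

  unshift<N : ∀ z i → unshift z i < N
  unshift<N z i = m%n<n (i + (N ∸ z)) N

  cycSucc⇒next : ∀ i j → j < N → CycSuccℕ N i j → j ≡ next i
  cycSucc⇒next i j j<N (inj₁ refl)        = sym (m<n⇒m%n≡m j<N)
  cycSucc⇒next i j j<N (inj₂ (i+1≡N , refl)) = sym (trans (cong (_% N) i+1≡N) (n%n≡0 N))

  next⇒cycSucc : ∀ i j → i < N → j ≡ next i → CycSuccℕ N i j
  next⇒cycSucc i j i<N refl with m≤n⇒m<n∨m≡n i<N
  ... | inj₁ i+1<N = inj₁ (sym (m<n⇒m%n≡m i+1<N))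
  ... | inj₂ i+1≡N = inj₂ (i+1≡N , trans (cong (_% N) i+1≡N) (n%n≡0 N))

  shift-next : ∀ z s → shift z (next s) ≡ next (shift z s)
  shift-next z s = begin
    (z + suc s % N) % N     ≡⟨ %-absorbʳ z (suc s) ⟩
    (z + suc s) % N         ≡⟨ cong (_% N) (+-suc z s) ⟩
    (1 + (z + s)) % N       ≡⟨ %-absorbʳ 1 (z + s) ⟨
    (1 + (z + s) % N) % N   ∎
    where open ≡-Reasoning

  unshift-shift : ∀ z s → z ≤ N → s < N → unshift z (shift z s) ≡ s
  unshift-shift z s z≤N s<N = begin
    ((z + s) % N + (N ∸ z)) % N ≡⟨ %-absorbˡ (z + s) (N ∸ z) ⟩
    (z + s + (N ∸ z)) % N       ≡⟨ cong (_% N) (trans (cong (_+ (N ∸ z)) (+-comm z s))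
                                     (trans (+-assoc s z (N ∸ z)) (cong (s +_) (m+[n∸m]≡n z≤N)))) ⟩
    (s + N) % N                 ≡⟨ [m+n]%n≡m%n s N ⟩
    s % N                       ≡⟨ m<n⇒m%n≡m s<N ⟩
    s                           ∎
    where open ≡-Reasoning

  shift-unshift : ∀ z i → z ≤ N → i < N → shift z (unshift z i) ≡ i
  shift-unshift z i z≤N i<N = begin
    (z + (i + (N ∸ z)) % N) % N ≡⟨ %-absorbʳ z (i + (N ∸ z)) ⟩
    (z + (i + (N ∸ z))) % N     ≡⟨ cong (_% N) (trans (sym (+-assoc z i (N ∸ z)))
                                     (trans (cong (_+ (N ∸ z)) (+-comm z i))
                                     (trans (+-assoc i z (N ∸ z)) (cong (i +_) (m+[n∸m]≡n z≤N))))) ⟩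
    (i + N) % N                 ≡⟨ [m+n]%n≡m%n i N ⟩
    i % N                       ≡⟨ m<n⇒m%n≡m i<N ⟩
    i                           ∎
    where open ≡-Reasoning

  shift-injective : ∀ z s t → z ≤ N → s < N → t < N → shift z s ≡ shift z t → s ≡ t
  shift-injective z s t z≤N s<N t<N eq = begin
    s                   ≡⟨ unshift-shift z s z≤N s<N ⟨
    unshift z (shift z s) ≡⟨ cong (unshift z) eq ⟩
    unshift z (shift z t) ≡⟨ unshift-shift z t z≤N t<N ⟩
    t                   ∎
    where open ≡-Reasoning

  shift-zero : ∀ z → z < N → shift z 0 ≡ z
  shift-zero z z<N = trans (cong (_% N) (+-identityʳ z)) (m<n⇒m%n≡m z<N)

  cycSucc-unshift : ∀ z s t → z ≤ N → s < N → t < N → CycSuccℕ N (shift z s) (shift z t) → CycSuccℕ N s t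
  cycSucc-unshift z s t z≤N s<N t<N c = next⇒cycSucc s t s<N
    (shift-injective z t (next s) z≤N t<N (m%n<n (suc s) N)
      (trans (cycSucc⇒next _ _ (shift<N z t) c) (sym (shift-next z s))))

  cycSucc-shift : ∀ z s t → s < N → t < N → CycSuccℕ N s t → CycSuccℕ N (shift z s) (shift z t)
  cycSucc-shift z s t s<N t<N c = next⇒cycSucc _ _ (shift<N z s)
    (trans (cong (shift z) (cycSucc⇒next s t t<N c)) (shift-next z s))

  cycConsec-unshift : ∀ z s t → z ≤ N → s < N → t < N →
                      CycConsecℕ N (shift z s) (shift z t) → CycConsecℕ N s t
  cycConsec-unshift z s t z≤N s<N t<N (inj₁ c) = inj₁ (cycSucc-unshift z s t z≤N s<N t<N c)
  cycConsec-unshift z s t z≤N s<N t<N (inj₂ c) = inj₂ (cycSucc-unshift z t s z≤N t<N s<N c)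

  cycConsec-shift : ∀ z s t → s < N → t < N → CycConsecℕ N s t → CycConsecℕ N (shift z s) (shift z t)
  cycConsec-shift z s t s<N t<N (inj₁ c) = inj₁ (cycSucc-shift z s t s<N t<N c)
  cycConsec-shift z s t s<N t<N (inj₂ c) = inj₂ (cycSucc-shift z t s t<N s<N c)

module _ {G : Graph} where

  rotate : (C : HoleSeq G) → ∀ z → z < suc (HoleSeq.top C) → HoleSeq G
  rotate C z z<N = record
    { top = top ; 3≤top = 3≤top ; cvtx = λ s → cvtx (shift z s)
    ; cvtx-injective = λ i j i<N j<N eq →
        shift-injective z i j (<⇒≤ z<N) i<N j<N (cvtx-injective _ _ (shift<N z i) (shift<N z j) eq)
    ; adj⇒cyc-consecutive = λ i j i<N j<N a →
        cycConsec-unshift z i j (<⇒≤ z<N) i<N j<N (adj⇒cyc-consecutive _ _ (shift<N z i) (shift<N z j) a)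
    ; cyc-consecutive⇒adj = λ i j i<N j<N c →
        cyc-consecutive⇒adj _ _ (shift<N z i) (shift<N z j) (cycConsec-shift z i j i<N j<N c) }
    where
    open HoleSeq C
    open CyclicShift top

  module _ (C : HoleSeq G) where
    open HoleSeq C

    1<N : 1 < suc top
    1<N = s≤s (≤-trans (s≤s z≤n) 3≤top)

    1≢top : 1 ≢ top
    1≢top 1≡top = <-irrefl 1≡top (≤-trans (s≤s (s≤s z≤n)) 3≤top)

    cyc-neighbours-of-0 : ∀ j → 0 < j → CycConsecℕ (suc top) 0 j → j ≡ 1 ⊎ j ≡ top
    cyc-neighbours-of-0 j _ (inj₁ (inj₁ 1≡j))       = inj₁ (sym 1≡j)
    cyc-neighbours-of-0 j 0<j (inj₁ (inj₂ (_ , j≡0))) = ⊥-elim (<-irrefl (sym j≡0) 0<j)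
    cyc-neighbours-of-0 j _ (inj₂ (inj₂ (j+1≡N , _))) = inj₂ (suc-injective j+1≡N)

    ¬cycConsec-1-top : ¬ CycConsecℕ (suc top) 1 top
    ¬cycConsec-1-top (inj₁ (inj₁ 2≡top))       = <-irrefl 2≡top 3≤top
    ¬cycConsec-1-top (inj₁ (inj₂ (2≡N , _)))   = 1≢top (suc-injective 2≡N)
    ¬cycConsec-1-top (inj₂ (inj₁ top+1≡1))     = <-irrefl (sym (suc-injective top+1≡1)) (≤-trans (s≤s z≤n) 3≤top)

    cvtx-≢ : ∀ {x y} → x < suc top → y < suc top → x ≢ y → cvtx x ≢ cvtx y
    cvtx-≢ x< y< x≢y = x≢y ∘ cvtx-injective _ _ x< y<

    cvtx-1≢cvtx-top : cvtx 1 ≢ cvtx top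
    cvtx-1≢cvtx-top eq = 1≢top (cvtx-injective 1 top 1<N ≤-refl eq)

    cvtx-1≁cvtx-top : ¬ Adj G (cvtx 1) (cvtx top)
    cvtx-1≁cvtx-top a = ¬cycConsec-1-top (adj⇒cyc-consecutive 1 top 1<N ≤-refl a)

    cvtx-0~cvtx-1 : Adj G (cvtx 0) (cvtx 1)
    cvtx-0~cvtx-1 = cyc-consecutive⇒adj 0 1 (s≤s z≤n) 1<N (inj₁ (inj₁ refl))

    cvtx-0~cvtx-top : Adj G (cvtx 0) (cvtx top)
    cvtx-0~cvtx-top = cyc-consecutive⇒adj 0 top (s≤s z≤n) ≤-refl (inj₂ (inj₂ (refl , refl)))

  module Rotated (C : HoleSeq G) (z : ℕ) (z<N : z < suc (HoleSeq.top C)) where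
    open HoleSeq C
    open CyclicShift top public

    C↻ : HoleSeq G
    C↻ = rotate C z z<N

    rotated-0 : HoleSeq.cvtx C↻ 0 ≡ cvtx z
    rotated-0 = cong cvtx (shift-zero z z<N)

    rotated-unshift : ∀ p → p < suc top → HoleSeq.cvtx C↻ (unshift z p) ≡ cvtx p
    rotated-unshift p p<N = cong cvtx (shift-unshift z p (<⇒≤ z<N) p<N)

    unshift-≢ : ∀ p q → p < suc top → q < suc top → p ≢ q → unshift z p ≢ unshift z q
    unshift-≢ p q p<N q<N p≢q eq = p≢q (cvtx-injective p q p<N q<N
      (trans (sym (rotated-unshift p p<N)) (trans (cong (HoleSeq.cvtx C↻) eq) (rotated-unshift q q<N))))

m≤o∸n⇒n+m≤o : ∀ {m n o} → n ≤ o → m ≤ o ∸ n → n + m ≤ o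
m≤o∸n⇒n+m≤o {n = n} n≤o m≤ = subst (_ ≤_) (m+[n∸m]≡n n≤o) (+-monoʳ-≤ n m≤)

module _ {G : Graph} where

  arc : (C : HoleSeq G) → ∀ p q → 1 ≤ p → p ≤ q → q < suc (HoleSeq.top C) → PathSeq G
  arc C p q 1≤p p≤q q<N = record
    { end = q ∸ p ; vtx = λ s → cvtx (p + s)
    ; vtx-injective = λ i j i≤ j≤ eq → +-cancelˡ-≡ p i j (cvtx-injective _ _ (in-range i≤) (in-range j≤) eq)
    ; adj⇒consecutive = λ i j i≤ j≤ a → consecutive (adj⇒cyc-consecutive _ _ (in-range i≤) (in-range j≤) a)
    ; step-adj = λ i i< → cyc-consecutive⇒adj _ _ (in-range (<⇒≤ i<)) (in-range i<) (inj₁ (inj₁ (sym (+-suc p i)))) }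
    where
    open HoleSeq C
    in-range : ∀ {i} → i ≤ q ∸ p → p + i < suc top
    in-range i≤ = ≤-<-trans (m≤o∸n⇒n+m≤o p≤q i≤) q<N
    -- since p ≥ 1 the arc never passes the wrap-around position 0
    succ : ∀ {i j} → CycSuccℕ (suc top) (p + i) (p + j) → suc i ≡ j
    succ {i} {j} (inj₁ eq)      = +-cancelˡ-≡ p (suc i) j (trans (+-suc p i) eq)
    succ         (inj₂ (_ , eq)) = ⊥-elim (<-irrefl (sym (m+n≡0⇒m≡0 p eq)) 1≤p)
    consecutive : ∀ {i j} → CycConsecℕ (suc top) (p + i) (p + j) → Consecutive i j
    consecutive (inj₁ c) = inj₁ (succ c)
    consecutive (inj₂ c) = inj₂ (succ c)

  subpath : (Q : PathSeq G) → ∀ p q → p ≤ q → q ≤ PathSeq.end Q → PathSeq G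
  subpath Q p q p≤q q≤end = record
    { end = q ∸ p ; vtx = λ s → vtx (p + s)
    ; vtx-injective = λ i j i≤ j≤ eq → +-cancelˡ-≡ p i j (vtx-injective _ _ (in-range i≤) (in-range j≤) eq)
    ; adj⇒consecutive = λ i j i≤ j≤ a → consecutive (adj⇒consecutive _ _ (in-range i≤) (in-range j≤) a)
    ; step-adj = λ i i< → subst (λ z → Adj G (vtx (p + i)) (vtx z)) (sym (+-suc p i))
                   (step-adj (p + i) (subst (_≤ end) (+-suc p i) (≤-trans (m≤o∸n⇒n+m≤o p≤q i<) q≤end))) }
    where
    open PathSeq Q
    in-range : ∀ {i} → i ≤ q ∸ p → p + i ≤ end
    in-range i≤ = ≤-trans (m≤o∸n⇒n+m≤o p≤q i≤) q≤end
    consecutive : ∀ {i j} → Consecutive (p + i) (p + j) → Consecutive i j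
    consecutive {i} {j} (inj₁ eq) = inj₁ (+-cancelˡ-≡ p (suc i) j (trans (+-suc p i) eq))
    consecutive {i} {j} (inj₂ eq) = inj₂ (+-cancelˡ-≡ p (suc j) i (trans (+-suc p j) eq))

  reverse : Symmetric (Adj G) → PathSeq G → PathSeq G
  reverse sym~ Q = record
    { end = end ; vtx = λ d → vtx (end ∸ d)
    ; vtx-injective = λ i j i≤ j≤ eq → ∸-cancelˡ-≡ i≤ j≤ (vtx-injective _ _ (m∸n≤m end i) (m∸n≤m end j) eq)
    ; adj⇒consecutive = consecutive
    ; step-adj = λ i i< → sym~ (subst (λ z → Adj G (vtx (end ∸ suc i)) (vtx z)) (sym (+-∸-assoc 1 i<))
                   (step-adj (end ∸ suc i) (≤-trans (≤-reflexive (sym (+-∸-assoc 1 i<))) (m∸n≤m end i)))) }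
    where
    open PathSeq Q
    flip-succ : ∀ i j → i ≤ end → j ≤ end → suc (end ∸ i) ≡ end ∸ j → i ≡ suc j
    flip-succ i j i≤ j≤ eq = +-cancelˡ-≡ (end ∸ i) i (suc j) (begin
      end ∸ i + i          ≡⟨ m∸n+n≡m i≤ ⟩
      end                  ≡⟨ m∸n+n≡m j≤ ⟨
      end ∸ j + j          ≡⟨ cong (_+ j) eq ⟨
      suc (end ∸ i) + j    ≡⟨ +-suc (end ∸ i) j ⟨
      end ∸ i + suc j      ∎)
      where open ≡-Reasoning
    consecutive : ∀ i j → i ≤ end → j ≤ end → Adj G (vtx (end ∸ i)) (vtx (end ∸ j)) → Consecutive i j
    consecutive i j i≤ j≤ a with adj⇒consecutive _ _ (m∸n≤m end i) (m∸n≤m end j) a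
    ... | inj₁ eq = inj₂ (sym (flip-succ i j i≤ j≤ eq))
    ... | inj₂ eq = inj₁ (sym (flip-succ j i j≤ i≤ eq))

closest-pair : {P R : ℕ → Set} → (∀ i → Dec (P i)) → (∀ i → Dec (R i)) → ∀ {x y} → x < y → P x → R y →
               Σ[ p ∈ ℕ ] Σ[ q ∈ ℕ ] (x ≤ p × p < q × q ≤ y × P p × R q × (∀ s → p < s → s < q → ¬ P s × ¬ R s))
closest-pair {P} {R} P? R? {x} {y} x<y px ry =
  scan x (suc x) (y ∸ suc x) (m+[n∸m]≡n x<y) ≤-refl (n<1+n x) px (λ s p<s s<p+1 → ⊥-elim (<-irrefl refl (≤-trans s<p+1 p<s)))
  where
  Result : Set
  Result = Σ[ p ∈ ℕ ] Σ[ q ∈ ℕ ] (x ≤ p × p < q × q ≤ y × P p × R q × (∀ s → p < s → s < q → ¬ P s × ¬ R s))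
  -- p is the last P-index seen so far and nothing strictly between p and cur satisfies P or R
  scan : ∀ p cur d → cur + d ≡ y → x ≤ p → p < cur → P p → (∀ s → p < s → s < cur → ¬ P s × ¬ R s) → Result
  scan p cur zero eq x≤p p<cur pp gap = p , cur , x≤p , p<cur , ≤-reflexive cur≡y , pp , subst R (sym cur≡y) ry , gap
    where cur≡y : cur ≡ y
          cur≡y = trans (sym (+-identityʳ cur)) eq
  scan p cur (suc d) eq x≤p p<cur pp gap with R? cur
  ... | yes rc = p , cur , x≤p , p<cur , subst (cur ≤_) eq (m≤m+n cur (suc d)) , pp , rc , gap
  ... | no ¬rc with P? cur
  ...   | yes pc = scan cur (suc cur) d (trans (sym (+-suc cur d)) eq) (≤-trans x≤p (<⇒≤ p<cur)) (n<1+n cur) pc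
                     (λ s c<s s<c+1 → ⊥-elim (<-irrefl refl (≤-trans s<c+1 c<s)))
  ...   | no ¬pc = scan p (suc cur) d (trans (sym (+-suc cur d)) eq) x≤p (m<n⇒m<1+n p<cur) pp gap′
    where
    gap′ : ∀ s → p < s → s < suc cur → ¬ P s × ¬ R s
    gap′ s p<s s<cur+1 with m≤n⇒m<n∨m≡n (≤-pred s<cur+1)
    ... | inj₁ s<cur = gap s p<s s<cur
    ... | inj₂ refl  = ¬pc , ¬rc

-- f extended to all of ℕ by the junk value f i₀
module _ {A : Set} {n : ℕ} (f : Fin n → A) (i₀ : Fin n) where

  extend : ℕ → A
  extend s with s <? n
  ... | yes s< = f (fromℕ< s<)
  ... | no _   = f i₀

  extend-fromℕ< : ∀ s (s< : s < n) → extend s ≡ f (fromℕ< s<)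
  extend-fromℕ< s s< with s <? n
  ... | yes _  = refl
  ... | no s≮ = ⊥-elim (s≮ s<)

  extend-toℕ : ∀ i → extend (toℕ i) ≡ f i
  extend-toℕ i = trans (extend-fromℕ< (toℕ i) (Fin.toℕ<n i)) (cong f (Fin.fromℕ<-toℕ i _))

  extend-is-value : ∀ s → Σ[ i ∈ Fin n ] extend s ≡ f i
  extend-is-value s with s <? n
  ... | yes s< = fromℕ< s< , refl
  ... | no _   = i₀ , refl

  extend-all : ∀ {Q : A → Set} → (∀ i → Q (f i)) → ∀ s → Q (extend s)
  extend-all {Q} Qf s = subst Q (sym (proj₂ (extend-is-value s))) (Qf (proj₁ (extend-is-value s)))

module _ {G : Graph} (P : CPath G) where

  nodeℕ : ℕ → V G
  nodeℕ = extend (node P) fzero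

  toPathSeq : PathSeq G
  toPathSeq = record
    { end = len P ; vtx = nodeℕ ; vtx-injective = injective
    ; adj⇒consecutive = consecutive ; step-adj = step }
    where
    idx : ∀ {s} → s ≤ len P → Fin (suc (len P))
    idx s≤ = fromℕ< (s≤s s≤)
    at : ∀ {s} (s≤ : s ≤ len P) → nodeℕ s ≡ node P (idx s≤)
    at s≤ = extend-fromℕ< (node P) fzero _ (s≤s s≤)
    toℕ-idx : ∀ {s} (s≤ : s ≤ len P) → toℕ (idx s≤) ≡ s
    toℕ-idx s≤ = Fin.toℕ-fromℕ< (s≤s s≤)
    injective : ∀ i j → i ≤ len P → j ≤ len P → nodeℕ i ≡ nodeℕ j → i ≡ j
    injective i j i≤ j≤ eq = trans (sym (toℕ-idx i≤))
      (trans (cong toℕ (inj P _ _ (trans (sym (at i≤)) (trans eq (at j≤))))) (toℕ-idx j≤))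
    consecutive : ∀ i j → i ≤ len P → j ≤ len P → Adj G (nodeℕ i) (nodeℕ j) → Consecutive i j
    consecutive i j i≤ j≤ a with proj₁ (chordless P (idx i≤) (idx j≤)) (subst₂ (Adj G) (at i≤) (at j≤) a)
    ... | inj₁ eq = inj₁ (trans (cong suc (sym (toℕ-idx i≤))) (trans eq (toℕ-idx j≤)))
    ... | inj₂ eq = inj₂ (trans (cong suc (sym (toℕ-idx j≤))) (trans eq (toℕ-idx i≤)))
    step : ∀ i → i < len P → Adj G (nodeℕ i) (nodeℕ (suc i))
    step i i< = subst₂ (Adj G) (sym (at (<⇒≤ i<))) (sym (at i<))
      (proj₂ (chordless P (idx (<⇒≤ i<)) (idx i<)) (inj₁ (trans (cong suc (toℕ-idx (<⇒≤ i<))) (sym (toℕ-idx i<)))))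

module _ {G : Graph} (P : CPath G) where

  nodeℕ-first : nodeℕ P 0 ≡ first P
  nodeℕ-first = extend-toℕ (node P) fzero fzero

  nodeℕ-last : nodeℕ P (len P) ≡ last P
  nodeℕ-last = trans (cong (nodeℕ P) (sym (Fin.toℕ-fromℕ (len P)))) (extend-toℕ (node P) fzero (fromℕ (len P)))

  node-at-0 : ∀ s → toℕ s ≡ 0 → node P s ≡ first P
  node-at-0 s eq = cong (node P) (Fin.toℕ-injective eq)

  node-at-len : ∀ s → toℕ s ≡ len P → node P s ≡ last P
  node-at-len s eq = cong (node P) (Fin.toℕ-injective (trans eq (sym (Fin.toℕ-fromℕ (len P)))))

module _ {G : Graph} (H : Hole G) where

  private
    0<size : 0 < size H
    0<size = ≤-trans (s≤s z≤n) (size≥4 H)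

  size≡suc-top : suc (pred (size H)) ≡ size H
  size≡suc-top = suc-pred (size H) {{ >-nonZero 0<size }}

  hnodeℕ : ℕ → V G
  hnodeℕ = extend (hnode H) (fromℕ< 0<size)

  toHoleSeq : HoleSeq G
  toHoleSeq = record
    { top = pred (size H) ; 3≤top = ≤-pred (subst (4 ≤_) (sym size≡suc-top) (size≥4 H)) ; cvtx = hnodeℕ
    ; cvtx-injective = injective ; adj⇒cyc-consecutive = consecutive ; cyc-consecutive⇒adj = adjacent }
    where
    N = suc (pred (size H))
    <size : ∀ {s} → s < N → s < size H
    <size s< = subst (_ <_) size≡suc-top s<
    at : ∀ {s} (s< : s < N) → hnodeℕ s ≡ hnode H (fromℕ< (<size s<))
    at s< = extend-fromℕ< (hnode H) (fromℕ< 0<size) _ (<size s<)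
    toℕ-idx : ∀ {s} (s< : s < N) → toℕ (fromℕ< (<size s<)) ≡ s
    toℕ-idx s< = Fin.toℕ-fromℕ< (<size s<)
    injective : ∀ i j → i < N → j < N → hnodeℕ i ≡ hnodeℕ j → i ≡ j
    injective i j i< j< eq = trans (sym (toℕ-idx i<))
      (trans (cong toℕ (hinj H _ _ (trans (sym (at i<)) (trans eq (at j<))))) (toℕ-idx j<))
    consecutive : ∀ i j → i < N → j < N → Adj G (hnodeℕ i) (hnodeℕ j) → CycConsecℕ N i j
    consecutive i j i< j< a = subst (λ n → CycConsecℕ n i j) (sym size≡suc-top)
      (subst₂ (CycConsecℕ (size H)) (toℕ-idx i<) (toℕ-idx j<)
        (proj₁ (hchordless H _ _) (subst₂ (Adj G) (at i<) (at j<) a)))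
    adjacent : ∀ i j → i < N → j < N → CycConsecℕ N i j → Adj G (hnodeℕ i) (hnodeℕ j)
    adjacent i j i< j< c = subst₂ (Adj G) (sym (at i<)) (sym (at j<))
      (proj₂ (hchordless H _ _) (subst₂ (CycConsecℕ (size H)) (sym (toℕ-idx i<)) (sym (toℕ-idx j<))
        (subst (λ n → CycConsecℕ n i j) size≡suc-top c)))

module Join {G : Graph} (sym~ : Symmetric (Adj G)) (P₁ P₂ : PathSeq G) where
  open PathSeq P₁ renaming (end to k₁; vtx to v₁; vtx-injective to inj₁′; adj⇒consecutive to cons₁; step-adj to step₁)
  open PathSeq P₂ renaming (end to k₂; vtx to v₂; vtx-injective to inj₂′; adj⇒consecutive to cons₂; step-adj to step₂)

  joined : ℕ → V G
  joined s with s ≤? k₁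
  ... | yes _ = v₁ s
  ... | no _  = v₂ (s ∸ suc k₁)

  joined-cases : ∀ s → joined s ≡ v₁ s ⊎ Σ[ d ∈ ℕ ] joined s ≡ v₂ d
  joined-cases s with s ≤? k₁
  ... | yes _ = inj₁ refl
  ... | no _  = inj₂ (_ , refl)

  private
    joined-left : ∀ s → s ≤ k₁ → joined s ≡ v₁ s
    joined-left s s≤ with s ≤? k₁
    ... | yes _ = refl
    ... | no s≰ = ⊥-elim (s≰ s≤)

    joined-right : ∀ {s} d → s ≡ suc k₁ + d → joined s ≡ v₂ d
    joined-right {s} d refl with s ≤? k₁
    ... | yes s≤ = ⊥-elim (<-irrefl refl (≤-trans (m≤m+n (suc k₁) d) s≤))
    ... | no _   = cong v₂ (m+n∸m≡n (suc k₁) d)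

    Side : ℕ → Set
    Side s = s ≤ k₁ ⊎ Σ[ d ∈ ℕ ] (d ≤ k₂ × s ≡ suc k₁ + d)

    side : ∀ s → s < suc (k₁ + suc k₂) → Side s
    side s s< with s ≤? k₁
    ... | yes s≤ = inj₁ s≤
    ... | no s≰  = inj₂ (s ∸ suc k₁ , d≤ , sym (m+[n∸m]≡n (≰⇒> s≰)))
      where
      d≤ : s ∸ suc k₁ ≤ k₂
      d≤ = subst (s ∸ suc k₁ ≤_) (trans (cong (_∸ suc k₁) (+-suc k₁ k₂)) (m+n∸m≡n k₁ k₂))
             (∸-monoˡ-≤ (suc k₁) (≤-pred s<))

  module _ (1≤k₁ : 1 ≤ k₁) (1≤k₂ : 1 ≤ k₂)
           (junction : Adj G (v₁ k₁) (v₂ 0)) (closure : Adj G (v₂ k₂) (v₁ 0))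
           (cross : ∀ s t → s ≤ k₁ → t ≤ k₂ → Adj G (v₁ s) (v₂ t) → (s ≡ k₁ × t ≡ 0) ⊎ (s ≡ 0 × t ≡ k₂))
           (disjoint : ∀ s t → s ≤ k₁ → t ≤ k₂ → v₁ s ≢ v₂ t) where

    private
      N = suc (k₁ + suc k₂)

      injective : ∀ s t → s < N → t < N → joined s ≡ joined t → s ≡ t
      injective s t s< t< eq with side s s< | side t t<
      ... | inj₁ s≤ | inj₁ t≤ = inj₁′ s t s≤ t≤ (trans (sym (joined-left s s≤)) (trans eq (joined-left t t≤)))
      ... | inj₁ s≤ | inj₂ (d , d≤ , t≡) =
            ⊥-elim (disjoint s d s≤ d≤ (trans (sym (joined-left s s≤)) (trans eq (joined-right d t≡))))
      ... | inj₂ (d , d≤ , s≡) | inj₁ t≤ =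
            ⊥-elim (disjoint t d t≤ d≤ (trans (sym (joined-left t t≤)) (trans (sym eq) (joined-right d s≡))))
      ... | inj₂ (d , d≤ , s≡) | inj₂ (d′ , d′≤ , t≡) = trans s≡ (trans (cong (suc k₁ +_)
            (inj₂′ d d′ d≤ d′≤ (trans (sym (joined-right d s≡)) (trans eq (joined-right d′ t≡))))) (sym t≡))

      cross-consecutive : ∀ s d → s ≤ k₁ → d ≤ k₂ → Adj G (v₁ s) (v₂ d) → CycConsecℕ N s (suc k₁ + d)
      cross-consecutive s d s≤ d≤ a with cross s d s≤ d≤ a
      ... | inj₁ (refl , refl) = inj₁ (inj₁ (cong suc (sym (+-identityʳ k₁))))
      ... | inj₂ (refl , refl) = inj₂ (inj₂ (cong suc (sym (+-suc k₁ k₂)) , refl))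

      consecutive : ∀ s t → s < N → t < N → Adj G (joined s) (joined t) → CycConsecℕ N s t
      consecutive s t s< t< a with side s s< | side t t<
      ... | inj₁ s≤ | inj₁ t≤ with cons₁ s t s≤ t≤ (subst₂ (Adj G) (joined-left s s≤) (joined-left t t≤) a)
      ...   | inj₁ eq = inj₁ (inj₁ eq)
      ...   | inj₂ eq = inj₂ (inj₁ eq)
      consecutive s t s< t< a | inj₁ s≤ | inj₂ (d , d≤ , refl) =
            cross-consecutive s d s≤ d≤ (subst₂ (Adj G) (joined-left s s≤) (joined-right d refl) a)
      consecutive s t s< t< a | inj₂ (d , d≤ , refl) | inj₁ t≤ =
            CycConsecℕ-sym (cross-consecutive t d t≤ d≤ (sym~ (subst₂ (Adj G) (joined-right d refl) (joined-left t t≤) a)))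
      consecutive s t s< t< a | inj₂ (d , d≤ , refl) | inj₂ (d′ , d′≤ , refl)
        with cons₂ d d′ d≤ d′≤ (subst₂ (Adj G) (joined-right d refl) (joined-right d′ refl) a)
      ...   | inj₁ eq = inj₁ (inj₁ (trans (sym (+-suc (suc k₁) d)) (cong (suc k₁ +_) eq)))
      ...   | inj₂ eq = inj₂ (inj₁ (trans (sym (+-suc (suc k₁) d′)) (cong (suc k₁ +_) eq)))

      succ-adj : ∀ s t → s < N → t < N → CycSuccℕ N s t → Adj G (joined s) (joined t)
      succ-adj s t s< t< (inj₁ refl) with side s s<
      ... | inj₁ s≤ with m≤n⇒m<n∨m≡n s≤
      ...   | inj₁ s<k₁ = subst₂ (Adj G) (sym (joined-left s s≤)) (sym (joined-left (suc s) s<k₁)) (step₁ s s<k₁)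
      ...   | inj₂ refl = subst₂ (Adj G) (sym (joined-left s s≤))
                            (sym (joined-right 0 (cong suc (sym (+-identityʳ k₁))))) junction
      succ-adj s t s< t< (inj₁ refl) | inj₂ (d , d≤ , refl) =
            subst₂ (Adj G) (sym (joined-right d refl)) (sym (joined-right (suc d) (sym (+-suc (suc k₁) d)))) (step₂ d d<)
        where
        d< : d < k₂
        d< = +-cancelˡ-≤ k₁ (suc d) k₂ (subst (_≤ k₁ + k₂) (sym (+-suc k₁ d))
               (≤-pred (subst (suc (suc (k₁ + d)) ≤_) (+-suc k₁ k₂) (≤-pred t<))))
      succ-adj s t s< t< (inj₂ (eq , refl)) =
            subst₂ (Adj G) (sym (joined-right k₂ (trans (suc-injective eq) (+-suc k₁ k₂)))) (sym (joined-left 0 z≤n)) closure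

    join : HoleSeq G
    join = record
      { top = k₁ + suc k₂ ; 3≤top = +-mono-≤ 1≤k₁ (s≤s 1≤k₂) ; cvtx = joined
      ; cvtx-injective = injective ; adj⇒cyc-consecutive = consecutive
      ; cyc-consecutive⇒adj = λ { s t s< t< (inj₁ c) → succ-adj s t s< t< c
                                ; s t s< t< (inj₂ c) → sym~ (succ-adj t s t< s< c) } }

module _ {G : Graph} (P : CPath G) (2≤len : 2 ≤ len P) where

  private
    L = len P
    1<1+L : 1 < suc L
    1<1+L = s≤s (≤-trans (s≤s z≤n) 2≤len)
    1+pred : suc (pred L) ≡ L
    1+pred = suc-pred L {{ >-nonZero (≤-trans (s≤s z≤n) 2≤len) }}
    pred<1+L : pred L < suc L
    pred<1+L = s≤s (≤-trans (n≤1+n _) (≤-reflexive 1+pred))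
    toℕ-last : toℕ (fromℕ L) ≡ L
    toℕ-last = Fin.toℕ-fromℕ L

  second penultimate : Fin (suc L)
  second      = fromℕ< 1<1+L
  penultimate = fromℕ< pred<1+L

  second-interior : Interior P second
  second-interior rewrite Fin.toℕ-fromℕ< 1<1+L = s≤s z≤n , 2≤len

  penultimate-interior : Interior P penultimate
  penultimate-interior rewrite Fin.toℕ-fromℕ< pred<1+L =
    ≤-pred (subst (2 ≤_) (sym 1+pred) 2≤len) , ≤-reflexive 1+pred

  first~second : Adj G (first P) (node P second)
  first~second = proj₂ (chordless P fzero second) (inj₁ (sym (Fin.toℕ-fromℕ< 1<1+L)))

  penultimate~last : Adj G (node P penultimate) (last P)
  penultimate~last = proj₂ (chordless P penultimate (fromℕ L))
    (inj₁ (trans (cong suc (Fin.toℕ-fromℕ< pred<1+L)) (trans 1+pred (sym toℕ-last))))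

  first≢last : first P ≢ last P
  first≢last eq = <-irrefl (trans (cong toℕ (inj P fzero (fromℕ L) eq)) toℕ-last) (≤-trans (s≤s z≤n) 2≤len)

  first≁last : ¬ Adj G (first P) (last P)
  first≁last a with proj₁ (chordless P fzero (fromℕ L)) a
  ... | inj₁ 1≡L = <-irrefl (trans 1≡L toℕ-last) 2≤len
  ... | inj₂ ()

-- Trees

≤-sum-tabulate : ∀ {n} (f : Fin n → ℕ) v → f v ≤ sum (tabulate f)
≤-sum-tabulate f fzero    = m≤m+n _ _
≤-sum-tabulate f (fsuc v) = ≤-trans (≤-sum-tabulate (f ∘ fsuc) v) (m≤n+m _ (f fzero))

+-≤-sum-tabulate : ∀ {n} (f : Fin n → ℕ) v w → v ≢ w → f v + f w ≤ sum (tabulate f)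
+-≤-sum-tabulate f fzero    fzero    v≢w = ⊥-elim (v≢w refl)
+-≤-sum-tabulate f fzero    (fsuc w) _   = +-monoʳ-≤ (f fzero) (≤-sum-tabulate (f ∘ fsuc) w)
+-≤-sum-tabulate f (fsuc v) fzero    _   =
  subst (_≤ sum (tabulate f)) (+-comm (f fzero) (f (fsuc v))) (+-monoʳ-≤ (f fzero) (≤-sum-tabulate (f ∘ fsuc) v))
+-≤-sum-tabulate f (fsuc v) (fsuc w) v≢w =
  ≤-trans (+-≤-sum-tabulate (f ∘ fsuc) v w (v≢w ∘ cong fsuc)) (m≤n+m _ (f fzero))

+-+-≤-sum-tabulate : ∀ {n} (f : Fin n → ℕ) u v w → u ≢ v → u ≢ w → v ≢ w →
                     f u + f v + f w ≤ sum (tabulate f)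
+-+-≤-sum-tabulate f fzero    fzero    _        u≢v _   _   = ⊥-elim (u≢v refl)
+-+-≤-sum-tabulate f fzero    (fsuc v) fzero    _   u≢w _   = ⊥-elim (u≢w refl)
+-+-≤-sum-tabulate f fzero    (fsuc v) (fsuc w) _   _   v≢w =
  subst (_≤ sum (tabulate f)) (sym (+-assoc (f fzero) _ _))
    (+-monoʳ-≤ (f fzero) (+-≤-sum-tabulate (f ∘ fsuc) v w (v≢w ∘ cong fsuc)))
+-+-≤-sum-tabulate f (fsuc u) fzero    fzero    _   _   v≢w = ⊥-elim (v≢w refl)
+-+-≤-sum-tabulate f (fsuc u) fzero    (fsuc w) u≢v u≢w v≢w =
  subst (_≤ sum (tabulate f)) (cong (_+ f (fsuc w)) (+-comm (f fzero) (f (fsuc u))))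
    (+-+-≤-sum-tabulate f fzero (fsuc u) (fsuc w) (u≢v ∘ sym) v≢w u≢w)
+-+-≤-sum-tabulate f (fsuc u) (fsuc v) fzero    u≢v u≢w v≢w =
  subst (_≤ sum (tabulate f)) (trans (+-assoc (f fzero) _ _) (+-comm (f fzero) _))
    (+-+-≤-sum-tabulate f fzero (fsuc u) (fsuc v) (u≢w ∘ sym) (v≢w ∘ sym) u≢v)
+-+-≤-sum-tabulate f (fsuc u) (fsuc v) (fsuc w) u≢v u≢w v≢w =
  ≤-trans (+-+-≤-sum-tabulate (f ∘ fsuc) u v w (u≢v ∘ cong fsuc) (u≢w ∘ cong fsuc) (v≢w ∘ cong fsuc))
          (m≤n+m _ (f fzero))

Acyclic : Tree → Set
Acyclic T = ∀ k (p : TPath T (suc (suc k))) → adj T (pnode p (fromℕ (suc (suc k)))) (pnode p fzero) ≡ true → ⊥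

module TreeFacts (T : Tree) where

  private
    M = m T

  edge-≡ : ∀ e f → SameEdge T e f → e ≡ f
  edge-≡ (u , v , u<v , uv) (.u , .v , u<v′ , uv′) (refl , refl) =
    cong₂ (λ a b → u , v , a , b) (<-irrelevant u<v u<v′) (uip uv uv′)
    where
    uip : {a b : Bool} (p q : a ≡ b) → p ≡ q
    uip refl refl = refl

  src≢tgt : ∀ e → src T e ≢ tgt T e
  src≢tgt (u , v , u<v , _) eq = <-irrefl (cong toℕ eq) u<v

  data Inc (w : Fin M) : PBV T → Set where
    inc : ∀ {e} → Incident T w e → Inc w (ln e)

  Inc? : ∀ w v → Dec (Inc w v)
  Inc? w (ln e) with w Fin.≟ src T e | w Fin.≟ tgt T e
  ... | yes w≡s | _       = yes (inc (inj₁ w≡s))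
  ... | no _    | yes w≡t = yes (inc (inj₂ w≡t))
  ... | no w≢s  | no w≢t  = no λ { (inc (inj₁ w≡s)) → w≢s w≡s ; (inc (inj₂ w≡t)) → w≢t w≡t }
  Inc? w vx = no λ ()
  Inc? w vy = no λ ()

  ends-adjacent : ∀ {w w′ v} → Inc w v → Inc w′ v → w ≢ w′ → adj T w w′ ≡ true
  ends-adjacent (inc (inj₁ refl)) (inc (inj₁ refl)) w≢w′ = ⊥-elim (w≢w′ refl)
  ends-adjacent {v = ln (u , v , _ , uv)} (inc (inj₁ refl)) (inc (inj₂ refl)) _ = uv
  ends-adjacent {v = ln (u , v , _ , uv)} (inc (inj₂ refl)) (inc (inj₁ refl)) _ = trans (adj-sym T v u) uv
  ends-adjacent (inc (inj₂ refl)) (inc (inj₂ refl)) w≢w′ = ⊥-elim (w≢w′ refl)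

  common-ends⇒≡ : ∀ {a b u v} → Inc a u → Inc b u → Inc a v → Inc b v → a ≢ b → u ≡ v
  common-ends⇒≡ {a} {b} {ln e} {ln f} (inc ae) (inc be) (inc af) (inc bf) a≢b = cong ln (edge-≡ e f (same ae be af bf))
    where
    src<tgt : ∀ (g : Edge T) → toℕ (src T g) < toℕ (tgt T g)
    src<tgt g = proj₁ (proj₂ (proj₂ g))
    same : Incident T a e → Incident T b e → Incident T a f → Incident T b f → SameEdge T e f
    same (inj₁ x) (inj₁ y) _ _ = ⊥-elim (a≢b (trans x (sym y)))
    same (inj₂ x) (inj₂ y) _ _ = ⊥-elim (a≢b (trans x (sym y)))
    same _ _ (inj₁ x) (inj₁ y) = ⊥-elim (a≢b (trans x (sym y)))
    same _ _ (inj₂ x) (inj₂ y) = ⊥-elim (a≢b (trans x (sym y)))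
    same (inj₁ x) (inj₂ y) (inj₁ z) (inj₂ w) = trans (sym x) z , trans (sym y) w
    same (inj₂ x) (inj₁ y) (inj₂ z) (inj₁ w) = trans (sym y) w , trans (sym x) z
    same (inj₁ x) (inj₂ y) (inj₂ z) (inj₁ w) = ⊥-elim (<-asym (src<tgt e)
      (subst₂ _<_ (cong toℕ (trans (sym w) y)) (cong toℕ (trans (sym z) x)) (src<tgt f)))
    same (inj₂ x) (inj₁ y) (inj₁ z) (inj₂ w) = ⊥-elim (<-asym (src<tgt e)
      (subst₂ _<_ (cong toℕ (trans (sym z) x)) (cong toℕ (trans (sym w) y)) (src<tgt f)))

  other-end : ∀ {w e} → Inc w (ln e) → Σ[ z ∈ Fin M ] (Inc z (ln e) × w ≢ z)
  other-end {e = e} (inc (inj₁ refl)) = tgt T e , inc (inj₂ refl) , src≢tgt e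
  other-end {e = e} (inc (inj₂ refl)) = src T e , inc (inj₁ refl) , src≢tgt e ∘ sym

  end-cases : ∀ {w₁ w₂ p e} → Inc w₁ (ln e) → Inc w₂ (ln e) → w₁ ≢ w₂ → Inc p (ln e) → p ≡ w₁ ⊎ p ≡ w₂
  end-cases (inc (inj₁ x)) (inc (inj₁ y)) w₁≢w₂ _ = ⊥-elim (w₁≢w₂ (trans x (sym y)))
  end-cases (inc (inj₂ x)) (inc (inj₂ y)) w₁≢w₂ _ = ⊥-elim (w₁≢w₂ (trans x (sym y)))
  end-cases (inc (inj₁ x)) (inc (inj₂ y)) _ (inc (inj₁ z)) = inj₁ (trans z (sym x))
  end-cases (inc (inj₁ x)) (inc (inj₂ y)) _ (inc (inj₂ z)) = inj₂ (trans z (sym y))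
  end-cases (inc (inj₂ x)) (inc (inj₁ y)) _ (inc (inj₁ z)) = inj₂ (trans z (sym y))
  end-cases (inc (inj₂ x)) (inc (inj₁ y)) _ (inc (inj₂ z)) = inj₁ (trans z (sym x))

  private
    indicator : Fin M → Fin M → ℕ
    indicator u v = if adj T u v then 1 else 0

    deg≡sum : ∀ u → deg T u ≡ sum (tabulate (indicator u))
    deg≡sum u = cong sum (map-tabulate (λ x → x) (indicator u))

    indicator-adj : ∀ {u v} → adj T u v ≡ true → indicator u v ≡ 1
    indicator-adj uv rewrite uv = refl

  2≤deg : ∀ {u v w} → adj T u v ≡ true → adj T u w ≡ true → v ≢ w → 2 ≤ deg T u
  2≤deg {u} {v} {w} uv uw v≢w rewrite deg≡sum u =
    subst (_≤ sum (tabulate (indicator u))) (cong₂ _+_ (indicator-adj uv) (indicator-adj uw))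
      (+-≤-sum-tabulate (indicator u) v w v≢w)

  3≤deg : ∀ {u v w z} → adj T u v ≡ true → adj T u w ≡ true → adj T u z ≡ true →
          v ≢ w → v ≢ z → w ≢ z → 3 ≤ deg T u
  3≤deg {u} {v} {w} {z} uv uw uz v≢w v≢z w≢z rewrite deg≡sum u =
    subst (_≤ sum (tabulate (indicator u))) (cong₂ _+_ (cong₂ _+_ (indicator-adj uv) (indicator-adj uw)) (indicator-adj uz))
      (+-+-≤-sum-tabulate (indicator u) v w z v≢w v≢z w≢z)

  leaf-neighbour-unique : ∀ {u v w} → deg T u ≡ 1 → adj T u v ≡ true → adj T u w ≡ true → v ≡ w
  leaf-neighbour-unique {v = v} {w} deg≡1 uv uw with v Fin.≟ w
  ... | yes v≡w = v≡w
  ... | no v≢w  = ⊥-elim (<-irrefl refl (subst (2 ≤_) deg≡1 (2≤deg uv uw v≢w)))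

  leaf-edge-unique : ∀ {ℓ e v} → deg T ℓ ≡ 1 → Inc ℓ (ln e) → Inc ℓ v → v ≡ ln e
  leaf-edge-unique {ℓ} {e} {ln f} deg≡1 ℓe ℓf with other-end ℓe | other-end ℓf
  ... | o , oe , ℓ≢o | z , zf , ℓ≢z = common-ends⇒≡ ℓf (subst (λ x → Inc x (ln f)) (sym o≡z) zf) ℓe oe ℓ≢o
    where
    o≡z : o ≡ z
    o≡z = leaf-neighbour-unique deg≡1 (ends-adjacent ℓe oe ℓ≢o) (ends-adjacent ℓf zf ℓ≢z)

  pendant⇒leaf : ∀ e → Pendant T e → Σ[ ℓ ∈ Fin M ] (deg T ℓ ≡ 1 × Inc ℓ (ln e))
  pendant⇒leaf e (inj₁ deg≡1) = src T e , deg≡1 , inc (inj₁ refl)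
  pendant⇒leaf e (inj₂ deg≡1) = tgt T e , deg≡1 , inc (inj₂ refl)

  pendant? : ∀ e → Dec (Pendant T e)
  pendant? e with deg T (src T e) ≟ 1 | deg T (tgt T e) ≟ 1
  ... | yes s≡1 | _       = yes (inj₁ s≡1)
  ... | no _    | yes t≡1 = yes (inj₂ t≡1)
  ... | no s≢1  | no t≢1  = no λ { (inj₁ s≡1) → s≢1 s≡1 ; (inj₂ t≡1) → t≢1 t≡1 }

  3≤deg-of-three-edges : ∀ {o u v w} → Inc o u → Inc o v → Inc o w → u ≢ v → u ≢ w → v ≢ w → 3 ≤ deg T o
  3≤deg-of-three-edges ou@(inc _) ov@(inc _) ow@(inc _) u≢v u≢w v≢w with other-end ou | other-end ov | other-end ow
  ... | z₁ , z₁u , o≢z₁ | z₂ , z₂v , o≢z₂ | z₃ , z₃w , o≢z₃ =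
    3≤deg (ends-adjacent ou z₁u o≢z₁) (ends-adjacent ov z₂v o≢z₂) (ends-adjacent ow z₃w o≢z₃)
      (λ eq → u≢v (common-ends⇒≡ ou z₁u ov (subst (λ z → Inc z _) (sym eq) z₂v) o≢z₁))
      (λ eq → u≢w (common-ends⇒≡ ou z₁u ow (subst (λ z → Inc z _) (sym eq) z₃w) o≢z₁))
      (λ eq → v≢w (common-ends⇒≡ ov z₂v ow (subst (λ z → Inc z _) (sym eq) z₃w) o≢z₂))

  data IsLine : PBV T → Set where
    line : ∀ e → IsLine (ln e)

  data NonLine : PBV T → Set where
    x-vertex : NonLine vx
    y-vertex : NonLine vy

  line-edge : ∀ {v} → IsLine v → Σ[ e ∈ Edge T ] v ≡ ln e
  line-edge (line e) = e , refl

  line-or-not : ∀ v → IsLine v ⊎ NonLine v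
  line-or-not (ln e) = inj₁ (line e)
  line-or-not vx     = inj₂ x-vertex
  line-or-not vy     = inj₂ y-vertex

  line-unless-nonline : ∀ {v} → ¬ NonLine v → IsLine v
  line-unless-nonline {v} ¬nv with line-or-not v
  ... | inj₁ lv = lv
  ... | inj₂ nv = ⊥-elim (¬nv nv)

  line≢nonline : ∀ {u v} → IsLine u → NonLine v → u ≢ v
  line≢nonline (line e) x-vertex ()
  line≢nonline (line e) y-vertex ()

  nonline? : ∀ v → Dec (NonLine v)
  nonline? (ln e) = no λ ()
  nonline? vx     = yes x-vertex
  nonline? vy     = yes y-vertex

  no-three-nonline : ∀ {u v w} → NonLine u → NonLine v → NonLine w → u ≢ v → u ≢ w → v ≢ w → ⊥
  no-three-nonline x-vertex x-vertex _ u≢v _ _ = u≢v refl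
  no-three-nonline y-vertex y-vertex _ u≢v _ _ = u≢v refl
  no-three-nonline x-vertex _ x-vertex _ u≢w _ = u≢w refl
  no-three-nonline y-vertex _ y-vertex _ u≢w _ = u≢w refl
  no-three-nonline _ x-vertex x-vertex _ _ v≢w = v≢w refl
  no-three-nonline _ y-vertex y-vertex _ _ v≢w = v≢w refl

-- The pyramid-basic graph and thetas

module PyramidBasicFacts (T : Tree) (lab : Edge T → Label) where
  open TreeFacts T

  G : Graph
  G = PyramidBasic T lab

  infix 4 _~_
  _~_ : PBV T → PBV T → Set
  _~_ = PBAdj T lab

  ~-sym : Symmetric _~_
  ~-sym {ln e} {ln f} (e≠f , w , we , wf) = (λ (s , t) → e≠f (sym s , sym t)) , w , wf , we
  ~-sym {ln e} {vx}   a = a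
  ~-sym {ln e} {vy}   a = a
  ~-sym {vx}   {ln e} a = a
  ~-sym {vx}   {vy}   a = tt
  ~-sym {vy}   {ln e} a = a
  ~-sym {vy}   {vx}   a = tt

  ~-irrefl : ∀ u → ¬ u ~ u
  ~-irrefl (ln e) (e≠e , _) = e≠e (refl , refl)

  common-end⇒~ : ∀ {w u v} → Inc w u → Inc w v → u ≢ v → u ~ v
  common-end⇒~ {w} {ln e} {ln f} (inc we) (inc wf) u≢v = (λ s → u≢v (cong ln (edge-≡ e f s))) , w , we , wf

  common-end⇒consecutive : (Q : PathSeq G) → let open PathSeq Q in
    ∀ {w} i j → i ≤ end → j ≤ end → i ≢ j → Inc w (vtx i) → Inc w (vtx j) → Consecutive i j
  common-end⇒consecutive Q i j i≤ j≤ i≢j wi wj =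
    PathSeq.adj⇒consecutive Q i j i≤ j≤ (common-end⇒~ wi wj (i≢j ∘ PathSeq.vtx-injective Q i j i≤ j≤))

  common-end⇒cyc-consecutive : (C : HoleSeq G) → let open HoleSeq C in
    ∀ {w} i j → i < suc top → j < suc top → i ≢ j → Inc w (cvtx i) → Inc w (cvtx j) → CycConsecℕ (suc top) i j
  common-end⇒cyc-consecutive C i j i< j< i≢j wi wj =
    HoleSeq.adj⇒cyc-consecutive C i j i< j< (common-end⇒~ wi wj (i≢j ∘ HoleSeq.cvtx-injective C i j i< j<))

  ~⇒common-end : ∀ e f → ln e ~ ln f → Σ[ w ∈ Fin (m T) ] (Inc w (ln e) × Inc w (ln f))
  ~⇒common-end e f (_ , w , we , wf) = w , inc we , inc wf

  pendant-neighbours-adjacent : ∀ e {u v} → Pendant T e → IsLine u → IsLine v → ln e ~ u → ln e ~ v → u ≢ v → u ~ v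
  pendant-neighbours-adjacent e pend (line f) (line g) ef eg f≢g with ~⇒common-end e f ef | ~⇒common-end e g eg
  ... | w₁ , w₁e , w₁f | w₂ , w₂e , w₂g with w₁ Fin.≟ w₂
  ... | yes refl = common-end⇒~ w₁f w₂g f≢g
  ... | no w₁≢w₂ with pendant⇒leaf e pend
  ... | ℓ , deg≡1 , ℓe with end-cases w₁e w₂e w₁≢w₂ ℓe
  ... | inj₁ refl = ⊥-elim (~-irrefl (ln e) (subst (ln e ~_) (leaf-edge-unique deg≡1 ℓe w₁f) ef))
  ... | inj₂ refl = ⊥-elim (~-irrefl (ln e) (subst (ln e ~_) (leaf-edge-unique deg≡1 ℓe w₂g) eg))

  ~nonline⇒pendant : ∀ e {v} → ln e ~ v → NonLine v → Pendant T e
  ~nonline⇒pendant e (pend , _) x-vertex = pend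
  ~nonline⇒pendant e (pend , _) y-vertex = pend

  distinct-nonline-adjacent : ∀ {u v} → NonLine u → NonLine v → u ≢ v → u ~ v
  distinct-nonline-adjacent x-vertex x-vertex u≢v = ⊥-elim (u≢v refl)
  distinct-nonline-adjacent x-vertex y-vertex _   = tt
  distinct-nonline-adjacent y-vertex x-vertex _   = tt
  distinct-nonline-adjacent y-vertex y-vertex u≢v = ⊥-elim (u≢v refl)

  -- a line vertex sees x or y according to its label, and x, y only see each other
  nonline-neighbour-unique : ∀ u {v w} → u ~ v → u ~ w → NonLine v → NonLine w → v ≡ w
  nonline-neighbour-unique (ln e) (_ , lx) (_ , ly) x-vertex y-vertex with trans (sym lx) ly
  ... | ()
  nonline-neighbour-unique (ln e) (_ , ly) (_ , lx) y-vertex x-vertex with trans (sym ly) lx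
  ... | ()
  nonline-neighbour-unique u _ _ x-vertex x-vertex = refl
  nonline-neighbour-unique u _ _ y-vertex y-vertex = refl
  nonline-neighbour-unique vx () _ x-vertex y-vertex
  nonline-neighbour-unique vx _ () y-vertex x-vertex
  nonline-neighbour-unique vy _ () x-vertex y-vertex
  nonline-neighbour-unique vy () _ y-vertex x-vertex

  Apart : PBV T → PBV T → Set
  Apart u v = u ≢ v × ¬ u ~ v

  nonline-not-apart : ∀ {u v} → NonLine u → NonLine v → ¬ Apart u v
  nonline-not-apart nu nv (u≢v , u≁v) = u≁v (distinct-nonline-adjacent nu nv u≢v)

  line-claw-free : ∀ e u v w → ln e ~ u → ln e ~ v → ln e ~ w → Apart u v → Apart u w → Apart v w → ⊥
  line-claw-free e u v w eu ev ew uv uw vw with line-or-not u | line-or-not v | line-or-not w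
  ... | inj₂ nu | inj₂ nv | _       = nonline-not-apart nu nv uv
  ... | inj₂ nu | _       | inj₂ nw = nonline-not-apart nu nw uw
  ... | _       | inj₂ nv | inj₂ nw = nonline-not-apart nv nw vw
  ... | inj₂ nu | inj₁ lv | inj₁ lw = proj₂ vw (pendant-neighbours-adjacent e (~nonline⇒pendant e eu nu) lv lw ev ew (proj₁ vw))
  ... | inj₁ lu | inj₂ nv | inj₁ lw = proj₂ uw (pendant-neighbours-adjacent e (~nonline⇒pendant e ev nv) lu lw eu ew (proj₁ uw))
  ... | inj₁ lu | inj₁ lv | inj₂ nw = proj₂ uv (pendant-neighbours-adjacent e (~nonline⇒pendant e ew nw) lu lv eu ev (proj₁ uv))
  ... | inj₁ (line f) | inj₁ (line g) | inj₁ (line h) with ~⇒common-end e f eu | ~⇒common-end e g ev | ~⇒common-end e h ew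
  ...   | w₁ , inc c₁ , i₁ | w₂ , inc c₂ , i₂ | w₃ , inc c₃ , i₃ = pigeonhole c₁ c₂ c₃
    where
    -- two of the three neighbours meet e at the same end
    pigeonhole : Incident T w₁ e → Incident T w₂ e → Incident T w₃ e → ⊥
    pigeonhole (inj₁ refl) (inj₁ refl) _ = proj₂ uv (common-end⇒~ i₁ i₂ (proj₁ uv))
    pigeonhole (inj₂ refl) (inj₂ refl) _ = proj₂ uv (common-end⇒~ i₁ i₂ (proj₁ uv))
    pigeonhole (inj₁ refl) _ (inj₁ refl) = proj₂ uw (common-end⇒~ i₁ i₃ (proj₁ uw))
    pigeonhole (inj₂ refl) _ (inj₂ refl) = proj₂ uw (common-end⇒~ i₁ i₃ (proj₁ uw))
    pigeonhole _ (inj₁ refl) (inj₁ refl) = proj₂ vw (common-end⇒~ i₂ i₃ (proj₁ vw))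
    pigeonhole _ (inj₂ refl) (inj₂ refl) = proj₂ vw (common-end⇒~ i₂ i₃ (proj₁ vw))

  no-theta : ¬ Theta G
  no-theta (a , b , P , ends , disjoint , nonadjacent) =
    nonline-not-apart (centre-nonline a second′ (λ i → second-interior (P i) (2≤len i)) a~second)
                      (centre-nonline b penultimate′ (λ i → penultimate-interior (P i) (2≤len i)) b~penultimate)
                      (a≢b , a≁b)
    where
    2≤len : ∀ i → 2 ≤ len (P i)
    2≤len i = proj₂ (proj₂ (ends i))
    second′ penultimate′ : ∀ i → Fin (suc (len (P i)))
    second′ i = second (P i) (2≤len i)
    penultimate′ i = penultimate (P i) (2≤len i)
    a~second : ∀ i → a ~ node (P i) (second′ i)
    a~second i = subst (_~ node (P i) (second′ i)) (proj₁ (ends i)) (first~second (P i) (2≤len i))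
    b~penultimate : ∀ i → b ~ node (P i) (penultimate′ i)
    b~penultimate i = ~-sym (subst (node (P i) (penultimate′ i) ~_) (proj₁ (proj₂ (ends i))) (penultimate~last (P i) (2≤len i)))
    centre-nonline : ∀ c (s : ∀ i → Fin (suc (len (P i)))) → (∀ i → Interior (P i) (s i)) →
                     (∀ i → c ~ node (P i) (s i)) → NonLine c
    centre-nonline c s interior c~s with line-or-not c
    ... | inj₂ nc = nc
    ... | inj₁ (line e) =
      ⊥-elim (line-claw-free e _ _ _ (c~s 0F) (c~s 1F) (c~s 2F) (apart 0F 1F (λ ())) (apart 0F 2F (λ ())) (apart 1F 2F (λ ())))
      where
      apart : ∀ i j → i ≢ j → Apart (node (P i) (s i)) (node (P j) (s j))
      apart i j i≢j = disjoint i j i≢j (s i) (s j) (interior i) , nonadjacent i j i≢j (s i) (s j) (interior i) (interior j)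
    a≢b : a ≢ b
    a≢b eq = first≢last (P 0F) (2≤len 0F) (trans (proj₁ (ends 0F)) (trans eq (sym (proj₁ (proj₂ (ends 0F))))))
    a≁b : ¬ a ~ b
    a≁b a~b = first≁last (P 0F) (2≤len 0F) (subst₂ _~_ (sym (proj₁ (ends 0F))) (sym (proj₁ (proj₂ (ends 0F)))) a~b)

-- Chordless paths of line vertices

module LineGraphOfAcyclic (T : Tree) (acyclic : Acyclic T) (lab : Edge T → Label) where
  open TreeFacts T
  open PyramidBasicFacts T lab

  private
    M = m T

  no-cycleℕ : ∀ K → 2 ≤ K → (f : ℕ → Fin M) → (∀ i j → i ≤ K → j ≤ K → f i ≡ f j → i ≡ j) →
              (∀ i → i < K → adj T (f i) (f (suc i)) ≡ true) → adj T (f K) (f 0) ≡ true → ⊥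
  no-cycleℕ (suc (suc k)) (s≤s (s≤s z≤n)) f f-inj f-adj closing = acyclic k cycle closing′
    where
    cycle : TPath T (suc (suc k))
    cycle = record
      { pnode = f ∘ toℕ
      ; pinj  = λ i j eq → Fin.toℕ-injective (f-inj _ _ (Fin.toℕ≤pred[n] i) (Fin.toℕ≤pred[n] j) eq)
      ; padj  = λ i → subst (λ x → adj T (f x) (f (suc (toℕ i))) ≡ true) (sym (Fin.toℕ-inject₁ i))
                          (f-adj (toℕ i) (Fin.toℕ<n i)) }
    closing′ : adj T (f (toℕ (fromℕ (suc (suc k))))) (f 0) ≡ true
    closing′ rewrite Fin.toℕ-fromℕ (suc (suc k)) = closing

  AllLinePath : PathSeq G → Set
  AllLinePath Q = ∀ i → i ≤ PathSeq.end Q → IsLine (PathSeq.vtx Q i)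

  common-end-of-line : ∀ {u v} → IsLine u → IsLine v → u ~ v → Σ[ w ∈ Fin M ] (Inc w u × Inc w v)
  common-end-of-line (line e) (line f) = ~⇒common-end e f

  -- Consecutive vertices of Q share an end; these shared ends, preceded by a and followed
  -- by b, trace a cycle in T closed by the edge ab.
  module _ (Q : PathSeq G) (all-line : AllLinePath Q) {a b : Fin M} (ab : adj T a b ≡ true) (a≢b : a ≢ b)
           (a∈first : Inc a (PathSeq.vtx Q 0)) (b∈last : Inc b (PathSeq.vtx Q (PathSeq.end Q)))
           (a-only-first : ∀ i → i ≤ PathSeq.end Q → Inc a (PathSeq.vtx Q i) → i ≡ 0)
           (b-only-last : ∀ i → i ≤ PathSeq.end Q → Inc b (PathSeq.vtx Q i) → i ≡ PathSeq.end Q) where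
    open PathSeq Q

    private
      shared : ∀ j → j < end → Σ[ w ∈ Fin M ] (Inc w (vtx j) × Inc w (vtx (suc j)))
      shared j j< = common-end-of-line (all-line j (<⇒≤ j<)) (all-line (suc j) j<) (step-adj j j<)

      junction : ℕ → Fin M
      junction zero = a
      junction (suc j) with j <? end
      ... | yes j< = proj₁ (shared j j<)
      ... | no _   = b

      junction-shared : ∀ j → j < end → Inc (junction (suc j)) (vtx j) × Inc (junction (suc j)) (vtx (suc j))
      junction-shared j j< with j <? end
      ... | yes j<′ = proj₂ (shared j j<′)
      ... | no j≮   = ⊥-elim (j≮ j<)

      junction-last : junction (suc end) ≡ b
      junction-last with end <? end
      ... | yes e<e = ⊥-elim (<-irrefl refl e<e)
      ... | no _    = refl

      junction-in-vtx : ∀ i → i ≤ end → Inc (junction i) (vtx i)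
      junction-in-vtx zero    _  = a∈first
      junction-in-vtx (suc j) j< = proj₂ (junction-shared j j<)

      junction-in-prev : ∀ i → i ≤ end → Inc (junction (suc i)) (vtx i)
      junction-in-prev i i≤ with m≤n⇒m<n∨m≡n i≤
      ... | inj₁ i< = proj₁ (junction-shared i i<)
      ... | inj₂ refl = subst (λ z → Inc z (vtx end)) (sym junction-last) b∈last

      a-not-later : ∀ j → j ≤ end → junction (suc j) ≢ a
      a-not-later j j≤ eq with m≤n⇒m<n∨m≡n j≤
      ... | inj₁ j<    = 1+n≢0 (a-only-first (suc j) j< (subst (λ z → Inc z (vtx (suc j))) eq (proj₂ (junction-shared j j<))))
      ... | inj₂ refl  = a≢b (trans (sym eq) junction-last)

      b-not-earlier : ∀ i → i < end → junction (suc i) ≢ b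
      b-not-earlier i i< eq =
        <-irrefl (b-only-last i (<⇒≤ i<) (subst (λ z → Inc z (vtx i)) eq (proj₁ (junction-shared i i<)))) i<

      -- an end shared by vtx i and vtx (j + 1) with i < j would make them adjacent
      inner-distinct : ∀ i j → i < j → j < end → junction (suc i) ≢ junction (suc j)
      inner-distinct i j i<j j< eq with common-end⇒consecutive Q i (suc j) (<⇒≤ (<-trans i<j j<)) j<
          (λ i≡ → <-asym i<j (subst (j <_) (sym i≡) (n<1+n j)))
          (proj₁ (junction-shared i (<-trans i<j j<)))
          (subst (λ z → Inc z (vtx (suc j))) (sym eq) (proj₂ (junction-shared j j<)))
      ... | inj₁ 1+i≡1+j = <-irrefl (suc-injective 1+i≡1+j) i<j
      ... | inj₂ 2+j≡i   = <-asym i<j (subst (j <_) 2+j≡i (<-trans (n<1+n j) (n<1+n (suc j))))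

      later-distinct : ∀ i j → i < j → j ≤ end → junction (suc i) ≢ junction (suc j)
      later-distinct i j i<j j≤ eq with m≤n⇒m<n∨m≡n j≤
      ... | inj₁ j<   = inner-distinct i j i<j j< eq
      ... | inj₂ refl = b-not-earlier i i<j (trans eq junction-last)

      junction-injective : ∀ i j → i ≤ suc end → j ≤ suc end → junction i ≡ junction j → i ≡ j
      junction-injective zero    zero    _  _  _  = refl
      junction-injective zero    (suc j) _  j≤ eq = ⊥-elim (a-not-later j (≤-pred j≤) (sym eq))
      junction-injective (suc i) zero    i≤ _  eq = ⊥-elim (a-not-later i (≤-pred i≤) eq)
      junction-injective (suc i) (suc j) i≤ j≤ eq with <-cmp i j
      ... | tri≈ _ i≡j _ = cong suc i≡j
      ... | tri< i<j _ _ = ⊥-elim (later-distinct i j i<j (≤-pred j≤) eq)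
      ... | tri> _ _ j<i = ⊥-elim (later-distinct j i j<i (≤-pred i≤) (sym eq))

      junction-adj : ∀ i → i < suc end → adj T (junction i) (junction (suc i)) ≡ true
      junction-adj i (s≤s i≤) = ends-adjacent (junction-in-vtx i i≤) (junction-in-prev i i≤)
        (λ eq → <-irrefl (junction-injective i (suc i) (m≤n⇒m≤1+n i≤) (s≤s i≤) eq) (n<1+n i))

    no-bridging-path : 1 ≤ end → ⊥
    no-bridging-path 1≤end = no-cycleℕ (suc end) (s≤s 1≤end) junction junction-injective junction-adj closing
      where
      closing : adj T (junction (suc end)) a ≡ true
      closing rewrite junction-last = trans (adj-sym T b a) ab

  AllLineHole : HoleSeq G → Set
  AllLineHole C = ∀ i → i < suc (HoleSeq.top C) → IsLine (HoleSeq.cvtx C i)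

  -- the common ends a of cvtx 0, cvtx 1 and b of cvtx 0, cvtx top are bridged by the arc 1 … top
  no-line-hole : (C : HoleSeq G) → AllLineHole C → ⊥
  no-line-hole C all-line = bridge (common-end-at-0 1 (1<N C) (cvtx-0~cvtx-1 C)) (common-end-at-0 top ≤-refl (cvtx-0~cvtx-top C))
    where
    open HoleSeq C
    1≤top : 1 ≤ top
    1≤top = ≤-trans (s≤s z≤n) 3≤top
    in-arc : ∀ {i} → i ≤ top ∸ 1 → suc i < suc top
    in-arc i≤ = s≤s (m≤o∸n⇒n+m≤o 1≤top i≤)
    common-end-at-0 : ∀ j → j < suc top → cvtx 0 ~ cvtx j → Σ[ w ∈ Fin M ] (Inc w (cvtx 0) × Inc w (cvtx j))
    common-end-at-0 j j< = common-end-of-line (all-line 0 (s≤s z≤n)) (all-line j j<)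
    no-common-end-1-top : ∀ {w} → Inc w (cvtx 1) → Inc w (cvtx top) → ⊥
    no-common-end-1-top w1 wtop = cvtx-1≁cvtx-top C (common-end⇒~ w1 wtop (cvtx-1≢cvtx-top C))
    position : ∀ {w} i → i ≤ top ∸ 1 → Inc w (cvtx 0) → Inc w (cvtx (suc i)) → suc i ≡ 1 ⊎ suc i ≡ top
    position i i≤ w0 wi = cyc-neighbours-of-0 C (suc i) (s≤s z≤n)
      (common-end⇒cyc-consecutive C 0 (suc i) (s≤s z≤n) (in-arc i≤) (λ ()) w0 wi)
    bridge : Σ[ a ∈ Fin M ] (Inc a (cvtx 0) × Inc a (cvtx 1)) → Σ[ b ∈ Fin M ] (Inc b (cvtx 0) × Inc b (cvtx top)) → ⊥
    bridge (a , a∈0 , a∈1) (b , b∈0 , b∈top) =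
      no-bridging-path (arc C 1 top ≤-refl 1≤top ≤-refl) (λ i i≤ → all-line (suc i) (in-arc i≤))
        (ends-adjacent a∈0 b∈0 a≢b) a≢b a∈1 (subst (λ z → Inc b (cvtx z)) (sym (m+[n∸m]≡n 1≤top)) b∈top)
        a-only-1 b-only-top
        (∸-monoˡ-≤ 1 (≤-trans (s≤s (s≤s z≤n)) 3≤top))
      where
      a≢b : a ≢ b
      a≢b refl = no-common-end-1-top a∈1 b∈top
      a-only-1 : ∀ i → i ≤ top ∸ 1 → Inc a (cvtx (1 + i)) → i ≡ 0
      a-only-1 i i≤ ai with position i i≤ a∈0 ai
      ... | inj₁ 1+i≡1   = suc-injective 1+i≡1
      ... | inj₂ 1+i≡top = ⊥-elim (no-common-end-1-top a∈1 (subst (λ z → Inc a (cvtx z)) 1+i≡top ai))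
      b-only-top : ∀ i → i ≤ top ∸ 1 → Inc b (cvtx (1 + i)) → i ≡ top ∸ 1
      b-only-top i i≤ bi with position i i≤ b∈0 bi
      ... | inj₁ 1+i≡1   = ⊥-elim (no-common-end-1-top (subst (λ z → Inc b (cvtx z)) 1+i≡1 bi) b∈top)
      ... | inj₂ 1+i≡top = cong (_∸ 1) 1+i≡top

  module _ (Q : PathSeq G) (all-line : AllLinePath Q) (c : Edge T)
           (avoids : ∀ i → i ≤ PathSeq.end Q → PathSeq.vtx Q i ≢ ln c) where
    open PathSeq Q

    private
      a b : Fin M
      a = src T c
      b = tgt T c
      a∈c : Inc a (ln c)
      a∈c = inc (inj₁ refl)
      b∈c : Inc b (ln c)
      b∈c = inc (inj₂ refl)

    -- between an occurrence of u and one of v, take the closest pair: the subpath joining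
    -- them is bridged by the edge uv = c
    ends-in-separate-vertices : ∀ u v → adj T u v ≡ true → u ≢ v → Inc u (ln c) → Inc v (ln c) →
                                ∀ x y → x < y → y ≤ end → Inc u (vtx x) → Inc v (vtx y) → ⊥
    ends-in-separate-vertices u v uv u≢v u∈c v∈c x y x<y y≤ u∈x v∈y
      with closest-pair (λ i → Inc? u (vtx i)) (λ i → Inc? v (vtx i)) x<y u∈x v∈y
    ... | p , q , _ , p<q , q≤y , up , vq , gap =
      no-bridging-path (subpath Q p q (<⇒≤ p<q) q≤end) (λ s s≤ → all-line (p + s) (in-range s≤)) uv u≢v
        (subst (λ z → Inc u (vtx z)) (sym (+-identityʳ p)) up)
        (subst (λ z → Inc v (vtx z)) (sym (m+[n∸m]≡n (<⇒≤ p<q))) vq)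
        u-only-first v-only-last (m<n⇒0<n∸m p<q)
      where
      q≤end : q ≤ end
      q≤end = ≤-trans q≤y y≤
      in-range : ∀ {s} → s ≤ q ∸ p → p + s ≤ end
      in-range s≤ = ≤-trans (m≤o∸n⇒n+m≤o (<⇒≤ p<q) s≤) q≤end
      not-both : ∀ i → i ≤ end → Inc u (vtx i) → Inc v (vtx i) → ⊥
      not-both i i≤ ui vi = avoids i i≤ (common-ends⇒≡ ui vi u∈c v∈c u≢v)
      u-only-first : ∀ s → s ≤ q ∸ p → Inc u (vtx (p + s)) → s ≡ 0
      u-only-first zero    _  _  = refl
      u-only-first (suc s) s≤ us with m≤n⇒m<n∨m≡n (m≤o∸n⇒n+m≤o (<⇒≤ p<q) s≤)
      ... | inj₁ p+s<q = ⊥-elim (proj₁ (gap (p + suc s) (m<m+n p (s≤s z≤n)) p+s<q) us)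
      ... | inj₂ p+s≡q = ⊥-elim (not-both q q≤end (subst (λ z → Inc u (vtx z)) p+s≡q us) vq)
      v-only-last : ∀ s → s ≤ q ∸ p → Inc v (vtx (p + s)) → s ≡ q ∸ p
      v-only-last s s≤ vs with m≤n⇒m<n∨m≡n (m≤o∸n⇒n+m≤o (<⇒≤ p<q) s≤)
      v-only-last zero    _ vs | inj₁ _ =
        ⊥-elim (not-both p (≤-trans (<⇒≤ p<q) q≤end) up (subst (λ z → Inc v (vtx z)) (+-identityʳ p) vs))
      v-only-last (suc s) _ vs | inj₁ p+s<q = ⊥-elim (proj₂ (gap (p + suc s) (m<m+n p (s≤s z≤n)) p+s<q) vs)
      v-only-last s       _ _  | inj₂ p+s≡q = trans (sym (m+n∸m≡n p s)) (cong (_∸ p) p+s≡q)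

    private
      end-of-c : ∀ i → i ≤ end → ln c ~ vtx i → Inc a (vtx i) ⊎ Inc b (vtx i)
      end-of-c i i≤ c~i with common-end-of-line (line c) (all-line i i≤) c~i
      ... | w , inc (inj₁ refl) , wi = inj₁ wi
      ... | w , inc (inj₂ refl) , wi = inj₂ wi

      a-b-apart : ∀ x y → x ≤ end → y ≤ end → x ≢ y → Inc a (vtx x) → Inc b (vtx y) → ⊥
      a-b-apart x y x≤ y≤ x≢y ax by with <-cmp x y
      ... | tri< x<y _ _ =
        ends-in-separate-vertices a b (ends-adjacent a∈c b∈c (src≢tgt c)) (src≢tgt c) a∈c b∈c x y x<y y≤ ax by
      ... | tri≈ _ x≡y _ = x≢y x≡y
      ... | tri> _ _ y<x =
        ends-in-separate-vertices b a (ends-adjacent b∈c a∈c (src≢tgt c ∘ sym)) (src≢tgt c ∘ sym) b∈c a∈c y x y<x x≤ by ax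

      no-three-sharing-an-end : ∀ {w} p q r → p ≤ end → q ≤ end → r ≤ end → p ≢ q → p ≢ r → q ≢ r →
                                Inc w (vtx p) → Inc w (vtx q) → Inc w (vtx r) → ⊥
      no-three-sharing-an-end p q r p≤ q≤ r≤ p≢q p≢r q≢r wp wq wr = no-consecutive-triple p q r p≢q p≢r q≢r
        (common-end⇒consecutive Q p q p≤ q≤ p≢q wp wq) (common-end⇒consecutive Q p r p≤ r≤ p≢r wp wr)
        (common-end⇒consecutive Q q r q≤ r≤ q≢r wq wr)

    at-most-two-neighbours : ∀ p q r → p ≤ end → q ≤ end → r ≤ end → p ≢ q → p ≢ r → q ≢ r →
                             ln c ~ vtx p → ln c ~ vtx q → ln c ~ vtx r → ⊥
    at-most-two-neighbours p q r p≤ q≤ r≤ p≢q p≢r q≢r cp cq cr with end-of-c p p≤ cp | end-of-c q q≤ cq | end-of-c r r≤ cr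
    ... | inj₁ ap | inj₁ aq | inj₁ ar = no-three-sharing-an-end p q r p≤ q≤ r≤ p≢q p≢r q≢r ap aq ar
    ... | inj₂ bp | inj₂ bq | inj₂ br = no-three-sharing-an-end p q r p≤ q≤ r≤ p≢q p≢r q≢r bp bq br
    ... | inj₁ ap | inj₂ bq | _       = a-b-apart p q p≤ q≤ p≢q ap bq
    ... | inj₂ bp | inj₁ aq | _       = a-b-apart q p q≤ p≤ (p≢q ∘ sym) aq bp
    ... | inj₁ ap | inj₁ _  | inj₂ br = a-b-apart p r p≤ r≤ p≢r ap br
    ... | inj₂ bp | inj₂ _  | inj₁ ar = a-b-apart r p r≤ p≤ (p≢r ∘ sym) ar bp

-- Prisms

other-two : ∀ (i : Fin 3) → Σ[ j ∈ Fin 3 ] Σ[ k ∈ Fin 3 ] (j ≢ k × j ≢ i × k ≢ i)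
other-two 0F = 1F , 2F , (λ ()) , (λ ()) , (λ ())
other-two 1F = 0F , 2F , (λ ()) , (λ ()) , (λ ())
other-two 2F = 0F , 1F , (λ ()) , (λ ()) , (λ ())

third : ∀ (i j : Fin 3) → i ≢ j → Σ[ k ∈ Fin 3 ] (k ≢ i × k ≢ j)
third 0F 0F i≢j = ⊥-elim (i≢j refl)
third 0F 1F _   = 2F , (λ ()) , (λ ())
third 0F 2F _   = 1F , (λ ()) , (λ ())
third 1F 0F _   = 2F , (λ ()) , (λ ())
third 1F 1F i≢j = ⊥-elim (i≢j refl)
third 1F 2F _   = 0F , (λ ()) , (λ ())
third 2F 0F _   = 1F , (λ ()) , (λ ())
third 2F 1F _   = 0F , (λ ()) , (λ ())
third 2F 2F i≢j = ⊥-elim (i≢j refl)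

module NoPrism (T : Tree) (acyclic : Acyclic T) (lab : Edge T → Label) where
  open TreeFacts T
  open PyramidBasicFacts T lab
  open LineGraphOfAcyclic T acyclic lab

  module _ (prism : Prism G) where
    private
      P         = proj₁ prism
      1≤len     = proj₁ (proj₂ prism)
      disjoint  = proj₁ (proj₂ (proj₂ prism))
      firsts    = proj₁ (proj₂ (proj₂ (proj₂ prism)))
      lasts     = proj₁ (proj₂ (proj₂ (proj₂ (proj₂ prism))))
      cross     = proj₂ (proj₂ (proj₂ (proj₂ (proj₂ prism))))

    -- two nonline vertices on different paths would be adjacent, hence both at the same end
    -- of their paths, and the third path would then have a vertex adjacent to both of them
    nonline-on-one-path : ∀ i j → i ≢ j → ∀ s t → NonLine (node (P i) s) → NonLine (node (P j) t) → ⊥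
    nonline-on-one-path i j i≢j s t ns nt
      with cross i j i≢j s t (distinct-nonline-adjacent ns nt (disjoint i j i≢j s t)) | third i j i≢j
    ... | inj₁ (s≡0 , t≡0) | k , k≢i , k≢j = disjoint i j i≢j s t
          (nonline-neighbour-unique (first (P k))
            (subst (first (P k) ~_) (sym (node-at-0 (P i) s s≡0)) (firsts k i k≢i))
            (subst (first (P k) ~_) (sym (node-at-0 (P j) t t≡0)) (firsts k j k≢j)) ns nt)
    ... | inj₂ (s≡len , t≡len) | k , k≢i , k≢j = disjoint i j i≢j s t
          (nonline-neighbour-unique (last (P k))
            (subst (last (P k) ~_) (sym (node-at-len (P i) s s≡len)) (lasts k i k≢i))
            (subst (last (P k) ~_) (sym (node-at-len (P j) t t≡len)) (lasts k j k≢j)) ns nt)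

    line-off-path : ∀ i s → NonLine (node (P i) s) → ∀ j → j ≢ i → ∀ t → IsLine (node (P j) t)
    line-off-path i s ns j j≢i t = line-unless-nonline (nonline-on-one-path i j (j≢i ∘ sym) s t ns)

    -- two of the paths, glued along the triangles, form a hole of the line graph
    two-line-paths : ∀ i j → i ≢ j → (∀ s → IsLine (node (P i) s)) → (∀ t → IsLine (node (P j) t)) → ⊥
    two-line-paths i j i≢j line-i line-j = no-line-hole hole all-line
      where
      Pᵢ Pⱼ : PathSeq G
      Pᵢ = toPathSeq (P i)
      Pⱼ = reverse ~-sym (toPathSeq (P j))
      lᵢ = len (P i)
      lⱼ = len (P j)
      open Join ~-sym Pᵢ Pⱼ
      cross′ : ∀ s t → s ≤ lᵢ → t ≤ lⱼ → nodeℕ (P i) s ~ nodeℕ (P j) (lⱼ ∸ t) → (s ≡ lᵢ × t ≡ 0) ⊎ (s ≡ 0 × t ≡ lⱼ)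
      cross′ s t s≤ t≤ a with cross i j i≢j (fromℕ< (s≤s s≤)) (fromℕ< (s≤s (m∸n≤m lⱼ t)))
                                (subst₂ _~_ (extend-fromℕ< (node (P i)) fzero s (s≤s s≤))
                                            (extend-fromℕ< (node (P j)) fzero (lⱼ ∸ t) (s≤s (m∸n≤m lⱼ t))) a)
      ... | inj₁ (s≡0 , lⱼ∸t≡0) = inj₂ (trans (sym (Fin.toℕ-fromℕ< (s≤s s≤))) s≡0 ,
                                       ≤-antisym t≤ (m∸n≡0⇒m≤n (trans (sym (Fin.toℕ-fromℕ< (s≤s (m∸n≤m lⱼ t)))) lⱼ∸t≡0)))
      ... | inj₂ (s≡lᵢ , lⱼ∸t≡lⱼ) = inj₁ (trans (sym (Fin.toℕ-fromℕ< (s≤s s≤))) s≡lᵢ ,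
                                       ∸-cancelˡ-≡ t≤ z≤n (trans (sym (Fin.toℕ-fromℕ< (s≤s (m∸n≤m lⱼ t)))) lⱼ∸t≡lⱼ))
      disjoint′ : ∀ s t → s ≤ lᵢ → t ≤ lⱼ → nodeℕ (P i) s ≢ nodeℕ (P j) (lⱼ ∸ t)
      disjoint′ s t _ _ eq with extend-is-value (node (P i)) fzero s | extend-is-value (node (P j)) fzero (lⱼ ∸ t)
      ... | s′ , s≡ | t′ , t≡ = disjoint i j i≢j s′ t′ (trans (sym s≡) (trans eq t≡))
      hole : HoleSeq G
      hole = join (1≤len i) (1≤len j)
        (subst₂ _~_ (sym (nodeℕ-last (P i))) (sym (nodeℕ-last (P j))) (lasts i j i≢j))
        (subst₂ _~_ (sym (trans (cong (nodeℕ (P j)) (n∸n≡0 lⱼ)) (nodeℕ-first (P j)))) (sym (nodeℕ-first (P i)))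
          (firsts j i (i≢j ∘ sym)))
        cross′ disjoint′
      all-line : AllLineHole hole
      all-line s _ with joined-cases s
      ... | inj₁ eq       = subst IsLine (sym eq) (extend-all (node (P i)) fzero {IsLine} line-i s)
      ... | inj₂ (d , eq) = subst IsLine (sym eq) (extend-all (node (P j)) fzero {IsLine} line-j (lⱼ ∸ d))

  no-prism : ¬ Prism G
  no-prism prism with Fin.any? (λ i → Fin.any? (λ s → nonline? (node (proj₁ prism i) s)))
  ... | yes (i , s , ns) with other-two i
  ...   | j , k , j≢k , j≢i , k≢i =
          two-line-paths prism j k j≢k (line-off-path prism i s ns j j≢i) (line-off-path prism i s ns k k≢i)
  no-prism prism | no none = two-line-paths prism 0F 1F (λ ())
    (λ s → line-unless-nonline λ n → none (0F , s , n)) (λ s → line-unless-nonline λ n → none (1F , s , n))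

-- Wheels

LeafNeighboursHaveDeg≤2 : Tree → Set
LeafNeighboursHaveDeg≤2 T = ∀ u → deg T u ≡ 1 → ∀ v → adj T u v ≡ true → deg T v ≤ 2

module NoWheel (T : Tree) (acyclic : Acyclic T) (stems : LeafNeighboursHaveDeg≤2 T) (lab : Edge T → Label) where
  open TreeFacts T
  open PyramidBasicFacts T lab
  open LineGraphOfAcyclic T acyclic lab

  module _ (C : HoleSeq G) where
    open HoleSeq C

    -- the two hole-neighbours of a pendant line vertex are nonadjacent, so one of them is not a line vertex
    nonline-next-to-pendant : ∀ s → s < suc top → ∀ e → cvtx s ≡ ln e → Pendant T e →
                              Σ[ t ∈ ℕ ] (t < suc top × ln e ~ cvtx t × NonLine (cvtx t))
    nonline-next-to-pendant s s<N e s≡e pend = pick (line-or-not (cvtx after)) (line-or-not (cvtx before))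
      where
      open Rotated C s s<N
      after before : ℕ
      after = shift s 1
      before = shift s top
      e~after : ln e ~ cvtx after
      e~after = subst (_~ cvtx after) (trans rotated-0 s≡e) (cvtx-0~cvtx-1 C↻)
      e~before : ln e ~ cvtx before
      e~before = subst (_~ cvtx before) (trans rotated-0 s≡e) (cvtx-0~cvtx-top C↻)
      pick : IsLine (cvtx after) ⊎ NonLine (cvtx after) → IsLine (cvtx before) ⊎ NonLine (cvtx before) →
             Σ[ t ∈ ℕ ] (t < suc top × ln e ~ cvtx t × NonLine (cvtx t))
      pick (inj₂ n) _        = after , shift<N s 1 , e~after , n
      pick _        (inj₂ n) = before , shift<N s top , e~before , n
      pick (inj₁ l) (inj₁ l′) = ⊥-elim (cvtx-1≁cvtx-top C↻
        (pendant-neighbours-adjacent e pend l l′ e~after e~before (cvtx-1≢cvtx-top C↻)))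

    private
      N = suc top

    nonline-near-0 : NonLine (cvtx 0) → ∀ t → t < N → 0 < t → NonLine (cvtx t) → t ≡ 1 ⊎ t ≡ top
    nonline-near-0 n0 t t< 0<t nt = cyc-neighbours-of-0 C t 0<t (adj⇒cyc-consecutive 0 t (s≤s z≤n) t<
      (distinct-nonline-adjacent n0 nt (cvtx-≢ C (s≤s z≤n) t< (λ 0≡t → <-irrefl 0≡t 0<t))))

    module _ (n0 : NonLine (cvtx 0)) where
      private
        1≤top : 1 ≤ top
        1≤top = ≤-trans (s≤s z≤n) 3≤top
        line⇒1≤ : ∀ t → IsLine (cvtx t) → 1 ≤ t
        line⇒1≤ t lt = n≢0⇒n>0 λ { refl → line≢nonline lt n0 refl }
        line-unless-end : ∀ t → 1 ≤ t → t ≤ top → (t ≡ 1 → IsLine (cvtx 1)) → (t ≡ top → IsLine (cvtx top)) →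
                          IsLine (cvtx t)
        line-unless-end t 1≤t t≤ at-1 at-top with line-or-not (cvtx t)
        ... | inj₁ lt = lt
        ... | inj₂ nt with nonline-near-0 n0 t (s≤s t≤) 1≤t nt
        ...   | inj₁ refl = ⊥-elim (line≢nonline (at-1 refl) nt refl)
        ...   | inj₂ refl = ⊥-elim (line≢nonline (at-top refl) nt refl)

      line-arc : Σ[ lo ∈ ℕ ] Σ[ hi ∈ ℕ ] (1 ≤ lo × lo ≤ hi × hi < N
                 × (∀ t → lo ≤ t → t ≤ hi → IsLine (cvtx t)) × (∀ t → t < N → IsLine (cvtx t) → lo ≤ t × t ≤ hi))
      line-arc with line-or-not (cvtx 1) | line-or-not (cvtx top)
      ... | inj₁ l₁ | inj₁ lₜ = 1 , top , ≤-refl , 1≤top , ≤-refl ,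
            (λ t 1≤t t≤ → line-unless-end t 1≤t t≤ (λ { refl → l₁ }) (λ { refl → lₜ })) ,
            (λ t t< lt → line⇒1≤ t lt , ≤-pred t<)
      ... | inj₂ n₁ | inj₁ lₜ = 2 , top , s≤s z≤n , ≤-trans (n≤1+n 2) 3≤top , ≤-refl ,
            (λ t 2≤t t≤ → line-unless-end t (≤-trans (n≤1+n 1) 2≤t) t≤ (λ { refl → ⊥-elim (<-irrefl refl 2≤t) }) (λ { refl → lₜ })) ,
            (λ t t< lt → ≤∧≢⇒< (line⇒1≤ t lt) (λ { refl → line≢nonline lt n₁ refl }) , ≤-pred t<)
      ... | inj₁ l₁ | inj₂ nₜ = 1 , pred top , ≤-refl , ≤-trans (s≤s z≤n) (pred-mono-≤ 3≤top) , s≤s (pred[n]≤n {top}) ,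
            (λ t 1≤t t≤ → line-unless-end t 1≤t (≤-trans t≤ pred[n]≤n) (λ { refl → l₁ })
               (λ { refl → ⊥-elim (<-irrefl refl (≤-trans (s≤s t≤) (≤-reflexive (suc-pred top {{ >-nonZero (≤-trans (s≤s z≤n) 3≤top) }})))) })) ,
            (λ t t< lt → line⇒1≤ t lt , <⇒≤pred (≤∧≢⇒< (≤-pred t<) (λ { refl → line≢nonline lt nₜ refl })))
      ... | inj₂ n₁ | inj₂ nₜ = ⊥-elim (cvtx-1≁cvtx-top C (distinct-nonline-adjacent n₁ nₜ (cvtx-1≢cvtx-top C)))

    at-most-two-neighbours-on-arc : ∀ e lo hi → 1 ≤ lo → lo ≤ hi → hi < N →
      (∀ t → lo ≤ t → t ≤ hi → IsLine (cvtx t)) → (∀ t → t < N → cvtx t ≢ ln e) →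
      ∀ p q r → lo ≤ p × p ≤ hi → lo ≤ q × q ≤ hi → lo ≤ r × r ≤ hi → p ≢ q → p ≢ r → q ≢ r →
      ln e ~ cvtx p → ln e ~ cvtx q → ln e ~ cvtx r → ⊥
    at-most-two-neighbours-on-arc e lo hi 1≤lo lo≤hi hi< line-on avoid p q r (lo≤p , p≤) (lo≤q , q≤) (lo≤r , r≤)
                                  p≢q p≢r q≢r e~p e~q e~r =
      at-most-two-neighbours (arc C lo hi 1≤lo lo≤hi hi<) all-line e avoid′ (p ∸ lo) (q ∸ lo) (r ∸ lo)
        (∸-monoˡ-≤ lo p≤) (∸-monoˡ-≤ lo q≤) (∸-monoˡ-≤ lo r≤)
        (distinct lo≤p lo≤q p≢q) (distinct lo≤p lo≤r p≢r) (distinct lo≤q lo≤r q≢r)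
        (shifted lo≤p e~p) (shifted lo≤q e~q) (shifted lo≤r e~r)
      where
      all-line : AllLinePath (arc C lo hi 1≤lo lo≤hi hi<)
      all-line i i≤ = line-on (lo + i) (m≤m+n lo i) (m≤o∸n⇒n+m≤o lo≤hi i≤)
      avoid′ : ∀ i → i ≤ hi ∸ lo → cvtx (lo + i) ≢ ln e
      avoid′ i i≤ = avoid (lo + i) (≤-<-trans (m≤o∸n⇒n+m≤o lo≤hi i≤) hi<)
      distinct : ∀ {x y} → lo ≤ x → lo ≤ y → x ≢ y → x ∸ lo ≢ y ∸ lo
      distinct lo≤x lo≤y x≢y = x≢y ∘ ∸-cancelʳ-≡ lo≤x lo≤y
      shifted : ∀ {x} → lo ≤ x → ln e ~ cvtx x → ln e ~ cvtx (lo + (x ∸ lo))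
      shifted lo≤x = subst (λ z → ln e ~ cvtx z) (sym (m+[n∸m]≡n lo≤x))

  module _ (C : HoleSeq G) (c : PBV T) (c-off : ∀ s → s < suc (HoleSeq.top C) → c ≢ HoleSeq.cvtx C s) where
    open HoleSeq C
    private
      N = suc top

    -- a line neighbour ln e of c is pendant, and its nonline hole-neighbour can only be c
    no-line-neighbour-of-nonline : NonLine c → ∀ x → x < N → IsLine (cvtx x) → ¬ c ~ cvtx x
    no-line-neighbour-of-nonline nc x x< l = go l refl
      where
      go : ∀ {u} → IsLine u → u ≡ cvtx x → ¬ c ~ u
      go (line e) e≡x c~e with nonline-next-to-pendant C x x< e (sym e≡x) (~nonline⇒pendant e (~-sym c~e) nc)
      ... | t , t< , e~t , nt = c-off t t< (nonline-neighbour-unique (ln e) (~-sym c~e) e~t nc nt)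

    nonline-centre : NonLine c → ∀ p q → p < N → q < N → p ≢ q → c ~ cvtx p → c ~ cvtx q → ⊥
    nonline-centre nc p q p< q< p≢q c~p c~q with line-or-not (cvtx p) | line-or-not (cvtx q)
    ... | inj₁ lp | _       = no-line-neighbour-of-nonline nc p p< lp c~p
    ... | _       | inj₁ lq = no-line-neighbour-of-nonline nc q q< lq c~q
    ... | inj₂ np | inj₂ nq = no-three-nonline nc np nq (c-off p p<) (c-off q q<) (cvtx-≢ C p< q< p≢q)

    -- two line neighbours of a pendant c would give its inner end degree 3, and c sees at most one of x, y
    module _ (e : Edge T) (c≡e : c ≡ ln e) (pend : Pendant T e) where
      private
        ℓ : Fin (m T)
        ℓ = proj₁ (pendant⇒leaf e pend)
        deg-ℓ≡1 : deg T ℓ ≡ 1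
        deg-ℓ≡1 = proj₁ (proj₂ (pendant⇒leaf e pend))
        ℓ∈e : Inc ℓ (ln e)
        ℓ∈e = proj₂ (proj₂ (pendant⇒leaf e pend))
        o : Fin (m T)
        o = proj₁ (other-end ℓ∈e)
        o∈e : Inc o (ln e)
        o∈e = proj₁ (proj₂ (other-end ℓ∈e))
        ℓ≢o : ℓ ≢ o
        ℓ≢o = proj₂ (proj₂ (other-end ℓ∈e))

        e≢cvtx : ∀ x → x < N → ln e ≢ cvtx x
        e≢cvtx x x< = subst (_≢ cvtx x) c≡e (c-off x x<)

        -- line neighbours of ln e meet it at its inner end o, since ℓ is a leaf
        inner-end : ∀ x → x < N → IsLine (cvtx x) → c ~ cvtx x → Inc o (cvtx x)
        inner-end x x< lx c~x with common-end-of-line (line e) lx (subst (_~ cvtx x) c≡e c~x)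
        ... | w , w∈e , w∈x with end-cases ℓ∈e o∈e ℓ≢o w∈e
        ...   | inj₁ refl = ⊥-elim (e≢cvtx x x< (sym (leaf-edge-unique deg-ℓ≡1 ℓ∈e w∈x)))
        ...   | inj₂ refl = w∈x

        two-line : ∀ x y → x < N → y < N → x ≢ y → IsLine (cvtx x) → IsLine (cvtx y) → c ~ cvtx x → c ~ cvtx y → ⊥
        two-line x y x< y< x≢y lx ly c~x c~y = <-irrefl refl (≤-trans
          (3≤deg-of-three-edges o∈e (inner-end x x< lx c~x) (inner-end y y< ly c~y)
            (e≢cvtx x x<) (e≢cvtx y y<) (cvtx-≢ C x< y< x≢y))
          (stems ℓ deg-ℓ≡1 o (ends-adjacent ℓ∈e o∈e ℓ≢o)))

        two-nonline : ∀ x y → x < N → y < N → x ≢ y → NonLine (cvtx x) → NonLine (cvtx y) → c ~ cvtx x → c ~ cvtx y → ⊥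
        two-nonline x y x< y< x≢y nx ny c~x c~y = cvtx-≢ C x< y< x≢y (nonline-neighbour-unique c c~x c~y nx ny)

      pendant-centre : ∀ p q r → p < N → q < N → r < N → p ≢ q → p ≢ r → q ≢ r →
                       c ~ cvtx p → c ~ cvtx q → c ~ cvtx r → ⊥
      pendant-centre p q r p< q< r< p≢q p≢r q≢r c~p c~q c~r
        with line-or-not (cvtx p) | line-or-not (cvtx q) | line-or-not (cvtx r)
      ... | inj₁ lp | inj₁ lq | _       = two-line p q p< q< p≢q lp lq c~p c~q
      ... | inj₁ lp | _       | inj₁ lr = two-line p r p< r< p≢r lp lr c~p c~r
      ... | _       | inj₁ lq | inj₁ lr = two-line q r q< r< q≢r lq lr c~q c~r
      ... | inj₂ np | inj₂ nq | _       = two-nonline p q p< q< p≢q np nq c~p c~q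
      ... | inj₂ np | _       | inj₂ nr = two-nonline p r p< r< p≢r np nr c~p c~r
      ... | _       | inj₂ nq | inj₂ nr = two-nonline q r q< r< q≢r nq nr c~q c~r

    module _ (e : Edge T) (c≡e : c ≡ ln e) (¬pend : ¬ Pendant T e)
             (p q r : ℕ) (p< : p < N) (q< : q < N) (r< : r < N) (p≢q : p ≢ q) (p≢r : p ≢ r) (q≢r : q ≢ r)
             (c~p : c ~ cvtx p) (c~q : c ~ cvtx q) (c~r : c ~ cvtx r) where
      private
        neighbour-line : ∀ {v} → c ~ v → IsLine v
        neighbour-line {v} c~v with line-or-not v
        ... | inj₁ lv = lv
        ... | inj₂ nv = ⊥-elim (¬pend (~nonline⇒pendant e (subst (_~ v) c≡e c~v) nv))

        -- rotate a nonline vertex of the hole to position 0; the neighbours of c all lie on the line arc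
        through-nonline : ∀ z → z < N → NonLine (cvtx z) → ⊥
        through-nonline z z< nz = on-arc (line-arc C↻ (subst NonLine (sym rotated-0) nz))
          where
          open Rotated C z z< hiding (N)
          e~ : ∀ {x} → x < N → c ~ cvtx x → ln e ~ HoleSeq.cvtx C↻ (unshift z x)
          e~ x< c~x = subst₂ _~_ c≡e (sym (rotated-unshift _ x<)) c~x
          on-arc : Σ[ lo ∈ ℕ ] Σ[ hi ∈ ℕ ] (1 ≤ lo × lo ≤ hi × hi < N
                     × (∀ t → lo ≤ t → t ≤ hi → IsLine (HoleSeq.cvtx C↻ t))
                     × (∀ t → t < N → IsLine (HoleSeq.cvtx C↻ t) → lo ≤ t × t ≤ hi)) → ⊥
          on-arc (lo , hi , 1≤lo , lo≤hi , hi< , inside , outside) =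
            at-most-two-neighbours-on-arc C↻ e lo hi 1≤lo lo≤hi hi< inside
              (λ t t< → subst (HoleSeq.cvtx C↻ t ≢_) c≡e (c-off (shift z t) (shift<N z t) ∘ sym))
              (unshift z p) (unshift z q) (unshift z r) (in-arc p< c~p) (in-arc q< c~q) (in-arc r< c~r)
              (unshift-≢ p q p< q< p≢q) (unshift-≢ p r p< r< p≢r) (unshift-≢ q r q< r< q≢r)
              (e~ p< c~p) (e~ q< c~q) (e~ r< c~r)
            where
            in-arc : ∀ {x} → x < N → c ~ cvtx x → lo ≤ unshift z x × unshift z x ≤ hi
            in-arc {x} x< c~x = outside (unshift z x) (unshift<N z x)
              (subst IsLine (sym (rotated-unshift x x<)) (neighbour-line c~x))

      nonpendant-centre : ⊥
      nonpendant-centre with anyUpTo? (λ t → nonline? (cvtx t)) N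
      ... | yes (z , z< , nz) = through-nonline z z< nz
      ... | no none = no-line-hole C λ t t< → line-unless-nonline (λ nt → none (t , t< , nt))

  wheel-centre : (C : HoleSeq G) (c : PBV T) → let open HoleSeq C in (∀ s → s < suc top → c ≢ cvtx s) →
                 ∀ p q r → p < suc top → q < suc top → r < suc top → p ≢ q → p ≢ r → q ≢ r →
                 c ~ cvtx p → c ~ cvtx q → c ~ cvtx r → ⊥
  wheel-centre C c c-off p q r p< q< r< p≢q p≢r q≢r c~p c~q c~r with line-or-not c
  ... | inj₂ nc = nonline-centre C c c-off nc p q p< q< p≢q c~p c~q
  ... | inj₁ lc with line-edge lc
  ...   | e , c≡e with pendant? e
  ...     | yes pend = pendant-centre C c c-off e c≡e pend p q r p< q< r< p≢q p≢r q≢r c~p c~q c~r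
  ...     | no ¬pend = nonpendant-centre C c c-off e c≡e ¬pend p q r p< q< r< p≢q p≢r q≢r c~p c~q c~r

  no-wheel : ¬ Wheel G
  no-wheel (H , c , c-off , i , j , l , (i≢j , i≢l , j≢l) , c~i , c~j , c~l) =
    wheel-centre (toHoleSeq H) c c-off′ (toℕ i) (toℕ j) (toℕ l) (in-range i) (in-range j) (in-range l)
      (i≢j ∘ Fin.toℕ-injective) (i≢l ∘ Fin.toℕ-injective) (j≢l ∘ Fin.toℕ-injective)
      (at i c~i) (at j c~j) (at l c~l)
    where
    in-range : ∀ (x : Fin (size H)) → toℕ x < suc (pred (size H))
    in-range x = subst (toℕ x <_) (sym (size≡suc-top H)) (Fin.toℕ<n x)
    at : ∀ x → c ~ hnode H x → c ~ hnodeℕ H (toℕ x)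
    at x = subst (c ~_) (sym (extend-toℕ (hnode H) _ x))
    c-off′ : ∀ s → s < suc (pred (size H)) → c ≢ hnodeℕ H s
    c-off′ s _ eq = c-off (proj₁ (extend-is-value (hnode H) _ s)) (trans eq (proj₂ (extend-is-value (hnode H) _ s)))

-- the labelling need not be proper, and of safety only the degree bound at leaves is used
lemma2p6 : (T : Tree) → IsTree T → Safe T →
    (lab : Edge T → Label) → ProperLabelling T lab →
    ¬ Theta (PyramidBasic T lab) × ¬ Wheel (PyramidBasic T lab) × ¬ Prism (PyramidBasic T lab)
lemma2p6 T (_ , acyclic) safe lab _ =
  PyramidBasicFacts.no-theta T lab ,
  NoWheel.no-wheel T acyclic (λ u deg≡1 v uv → proj₁ (safe u deg≡1 v uv)) lab ,
  NoPrism.no-prism T acyclic lab
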